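{- Let $G=(V,E,L)$ be a looped simple graph. Then $G$ is a rigid $\mathcal{M}_{lc}$-circuit that is not balanced if and only if $G$ is the $2$-sum of a rigid $\mathcal{M}_{lc}$-circuit and a flexible $\mathcal{M}_{lc}$-circuit.
   Context: A looped simple graph $G=(V,E,L)$: $E$ is a set of non-loop edges with no parallel edges, $L$ a set of loops (several may be at one vertex). For $X\subseteq V$, $i_E(X)$, $i_L(X)$ are the numbers of edges, resp. loops, induced by $X$, and $i_{E\cup L}(X)=i_E(X)+i_L(X)$. $G$ is a rigid $\mathcal{M}_{lc}$-circuit if $|E|+|L|=2|V|+1$, $i_E(X)\le2|X|-3$ for all $X\subseteq V$ with $|X|\ge2$, and $i_{E\cup L}(X)\le 2|X|$ for all $X\subsetneq V$. $G$ is a flexible $\mathcal{M}_{lc}$-circuit if $L=\emptyset$, $|E|=2|V|-2$ and $i_E(X)\le 2|X|-3$ for all $X\subsetneq V$ with $|X|\ge 2$. $G$ is balanced if for every $X\subseteq V$ with $|X|=2$ each connected component of $G-X$ contains a loop. $G$ is the $2$-sum of $G_1=(V_1,E_1,L_1)$ and $G_2=(V_2,E_2,L_2)$ along an edge $uv$ if $V_1\cup V_2=V$, $V_1\cap V_2=\{u,v\}$, $E_1\cap E_2=\{uv\}$, $E=(E_1\cup E_2)-uv$, $L=L_1\cup L_2$, $L_1\cap L_2=\emptyset$. -}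

module Defs where

open import Data.Nat using (ℕ; zero; suc; _+_; _*_; _≤_)
open import Data.Bool using (Bool; true; false; _∧_; _∨_; not; if_then_else_)
open import Data.Fin using (Fin; toℕ)
open import Data.Fin.Properties using (_≟_)
import Data.Nat.Properties as ℕP
open import Data.List using (List; map; allFin)
open import Data.Nat.ListAction using (sum)
open import Data.Product using (Σ; ∃; ∃-syntax; _×_)
open import Relation.Nullary using (¬_)
open import Relation.Nullary.Decidable using (⌊_⌋)
open import Relation.Binary.PropositionalEquality using (_≡_)

-- A looped simple graph whose vertex set V is a subset of Fin n.
-- L x : number of loops at vertex x (loops only at vertices of V).
record LGraph (n : ℕ) : Set where
  field
    V     : Fin n → Bool
    E     : Fin n → Fin n → Bool
    L     : Fin n → ℕ
    E-sym : ∀ x y → E x y ≡ E y x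
    E-irr : ∀ x → E x x ≡ false
    E-V   : ∀ x y → E x y ≡ true → V x ≡ true
    L-V   : ∀ x → V x ≡ false → L x ≡ 0
open LGraph public

VSet : ℕ → Set
VSet n = Fin n → Bool

b2n : Bool → ℕ
b2n true  = 1
b2n false = 0

card : ∀ {n} → VSet n → ℕ
card {n} X = sum (map (λ x → b2n (X x)) (allFin n))

_⊆_ : ∀ {n} → VSet n → VSet n → Set
X ⊆ Y = ∀ x → X x ≡ true → Y x ≡ true

_⊊_ : ∀ {n} → VSet n → VSet n → Set
X ⊊ Y = X ⊆ Y × ¬ (∀ x → X x ≡ Y x)

iE : ∀ {n} → LGraph n → VSet n → ℕ
iE {n} G X = sum (map (λ x → sum (map (λ y →
  b2n (⌊ ℕP._<?_ (toℕ x) (toℕ y) ⌋ ∧ X x ∧ X y ∧ E G x y)) (allFin n))) (allFin n))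

iL : ∀ {n} → LGraph n → VSet n → ℕ
iL {n} G X = sum (map (λ x → if X x then L G x else 0) (allFin n))

iEL : ∀ {n} → LGraph n → VSet n → ℕ
iEL G X = iE G X + iL G X

RigidCircuit : ∀ {n} → LGraph n → Set
RigidCircuit G =
  (iE G (V G) + iL G (V G) ≡ 2 * card (V G) + 1)
  × (∀ X → X ⊆ V G → 2 ≤ card X → iE G X + 3 ≤ 2 * card X)
  × (∀ X → X ⊊ V G → iEL G X ≤ 2 * card X)

-- flexible M_lc-circuit  (|E| = 2|V| - 2 written as |E| + 2 = 2|V|)
FlexibleCircuit : ∀ {n} → LGraph n → Set
FlexibleCircuit G =
  (∀ x → L G x ≡ 0)
  × (iE G (V G) + 2 ≡ 2 * card (V G))
  × (∀ X → X ⊊ V G → 2 ≤ card X → iE G X + 3 ≤ 2 * card X)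

-- Reach G X u w : w is reachable from u in G - X by a path whose
-- vertices after u all lie outside X (u itself is assumed outside X by users).
data Reach {n} (G : LGraph n) (X : VSet n) : Fin n → Fin n → Set where
  here : ∀ {v} → Reach G X v v
  step : ∀ {u v w} → E G u v ≡ true → X v ≡ false → Reach G X v w → Reach G X u w

-- balanced: for every X ⊆ V with |X| = 2, every connected component of
-- G - X contains a loop, i.e. from every vertex of V - X one can reach
-- (inside G - X) a vertex carrying a loop.
Balanced : ∀ {n} → LGraph n → Set
Balanced G = ∀ X → X ⊆ V G → card X ≡ 2 →
  ∀ v → V G v ≡ true → X v ≡ false →
  ∃[ w ] (Reach G X v w × ¬ (L G w ≡ 0))

IsTwoSum : ∀ {n} → LGraph n → LGraph n → LGraph n → Set
IsTwoSum {n} G G₁ G₂ = ∃[ u ] ∃[ v ]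
  ((∀ x → V G x ≡ (V G₁ x ∨ V G₂ x))
  × (∀ x → (V G₁ x ∧ V G₂ x) ≡ (⌊ x ≟ u ⌋ ∨ ⌊ x ≟ v ⌋))
  × (∀ x y → (E G₁ x y ∧ E G₂ x y) ≡ isUV u v x y)
  × (∀ x y → E G x y ≡ ((E G₁ x y ∨ E G₂ x y) ∧ not (isUV u v x y)))
  × (∀ x → L G x ≡ L G₁ x + L G₂ x))
  where
  isUV : Fin n → Fin n → Fin n → Fin n → Bool
  isUV u v x y = (⌊ x ≟ u ⌋ ∧ ⌊ y ≟ v ⌋) ∨ (⌊ x ≟ v ⌋ ∧ ⌊ y ≟ u ⌋)

module Submission where

-- Everything reduces to counting. Vertex, loop and edge counts are finite sums: weights of
-- vertex sets and weighted counts of pairs, which are modular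
-- (f(A ∪ B) + f(A ∩ B) = f(A) + f(B)) when no edge crosses between A ∖ B and B ∖ A.
-- For a 2-sum along uv this gives
--   i_E(X) + 2[u, v ∈ X] = i_E₁(X ∩ V₁) + i_E₂(X ∩ V₂),
--   |X| + [u ∈ X] + [v ∈ X] = |X ∩ V₁| + |X ∩ V₂|,
-- and the circuit conditions become inequalities between natural numbers that are glued or
-- cut apart by a few arithmetic lemmas (glue-bounds, glue-count, tight-split, cut-tight).
--
-- (⇐, module TwoSum) The counts of G follow by gluing those of G₁ and G₂; G is not balanced
-- because a vertex of V₂ ∖ {u, v}, which exists as |E₂| = 2|V₂| − 2 > 1, only reaches
-- loopless vertices of V₂ in G − {u, v}.
-- (⇒, module Separation) A decidable search turns non-balancedness into vertices a, b and a
-- loopless component C of G − {a, b}. Counting over Y = C ∪ {a, b} and Z = V ∖ C forces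
-- ab ∉ E, i_E(Y) = 2|Y| − 3 and i_E(Z) + i_L(Z) = 2|Z|; then G[Z] + ab is a rigid and
-- G[Y] + ab a flexible circuit, and G is their 2-sum along ab.

open import Defs
open import Data.Nat using (ℕ; zero; suc; _+_; _*_; _≤_; _<_; z≤n; _<?_; _≤?_)
import Data.Nat as ℕ
open import Data.Nat.Properties hiding (_≟_)
open import Data.Nat.Tactic.RingSolver using (solve-∀)
open import Data.Bool using (Bool; true; false; _∧_; _∨_; not; if_then_else_)
import Data.Bool.Properties as Bool
open import Data.Bool.Properties using (∧-identityʳ; ∧-zeroʳ; ∨-zeroʳ; ∨-identityʳ)
open import Data.Fin using (Fin; toℕ; punchIn; punchOut) renaming (zero to fzero; suc to fsuc)
open import Data.Fin.Properties
  using (_≟_; any?; all?; punchInᵢ≢i; punchIn-punchOut; punchIn-injective; toℕ-injective)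
open import Data.List using (map; allFin; tabulate)
open import Data.List.Properties using (map-tabulate)
open import Data.Nat.ListAction using (sum)
open import Data.Product using (∃-syntax; _×_; _,_; proj₁; proj₂)
open import Data.Sum using (_⊎_; inj₁; inj₂)
open import Data.Empty using (⊥; ⊥-elim)
open import Function using (_∘_; id)
open import Function.Bundles using (_⇔_; mk⇔; Equivalence)
open import Relation.Nullary using (¬_; Dec; yes; no)
open import Relation.Nullary.Decidable using (⌊_⌋; _×-dec_; ¬?; map′; toWitness; fromWitness)
open import Relation.Binary.PropositionalEquality
open import Algebra.Properties.CommutativeMonoid.Sum +-0-commutativeMonoid
  using (sum-cong-≗; ∑-distrib-+; sum-replicate-zero; sum-remove) renaming (sum to ∑)

true≢false : ∀ {A : Set} → true ≡ false → A
true≢false ()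

∧-true : ∀ {a b} → (a ∧ b) ≡ true → a ≡ true × b ≡ true
∧-true {true} b≡true = refl , b≡true

∨-true : ∀ {a b} → (a ∨ b) ≡ true → a ≡ true ⊎ b ≡ true
∨-true {true}  _      = inj₁ refl
∨-true {false} b≡true = inj₂ b≡true

∨-introʳ : ∀ a {b} → b ≡ true → (a ∨ b) ≡ true
∨-introʳ a b≡true = trans (cong (a ∨_) b≡true) (∨-zeroʳ a)

∨-false : ∀ {a b} → (a ∨ b) ≡ false → a ≡ false × b ≡ false
∨-false {false} b≡false = refl , b≡false

false-if-not-true : ∀ {b} → ¬ (b ≡ true) → b ≡ false
false-if-not-true {true}  b≢true = ⊥-elim (b≢true refl)
false-if-not-true {false} _      = refl

not-true : ∀ {b} → not b ≡ true → b ≡ false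
not-true {false} _ = refl

≟-refl : ∀ {n} (x : Fin n) → ⌊ x ≟ x ⌋ ≡ true
≟-refl x with x ≟ x
... | yes _ = refl
... | no x≢x = ⊥-elim (x≢x refl)

≟-≢ : ∀ {n} {x y : Fin n} → x ≢ y → ⌊ x ≟ y ⌋ ≡ false
≟-≢ {x = x} {y} x≢y with x ≟ y
... | yes x≡y = ⊥-elim (x≢y x≡y)
... | no _ = refl

sum-allFin : ∀ {n} (f : Fin n → ℕ) → sum (map f (allFin n)) ≡ ∑ f
sum-allFin f = trans (cong sum (map-tabulate id f)) (sum-tabulate f)
  where
  sum-tabulate : ∀ {n} (f : Fin n → ℕ) → sum (tabulate f) ≡ ∑ f
  sum-tabulate {zero}  f = refl
  sum-tabulate {suc n} f = cong (f fzero +_) (sum-tabulate (f ∘ fsuc))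

∑-mono : ∀ {n} {f g : Fin n → ℕ} → (∀ x → f x ≤ g x) → ∑ f ≤ ∑ g
∑-mono {zero}  _   = z≤n
∑-mono {suc n} f≤g = +-mono-≤ (f≤g fzero) (∑-mono (f≤g ∘ fsuc))

∑-zero : ∀ {n} {f : Fin n → ℕ} → (∀ x → f x ≡ 0) → ∑ f ≡ 0
∑-zero {n} f≡0 = trans (sum-cong-≗ f≡0) (sum-replicate-zero n)

∑-term : ∀ {n} (f : Fin n → ℕ) x → f x ≤ ∑ f
∑-term f fzero    = m≤m+n _ _
∑-term f (fsuc x) = ≤-trans (∑-term (f ∘ fsuc) x) (m≤n+m _ _)

∑∑-distrib-+ : ∀ {n} (f g : Fin n → Fin n → ℕ) →
  ∑ (λ x → ∑ λ y → f x y + g x y) ≡ ∑ (λ x → ∑ (f x)) + ∑ (λ x → ∑ (g x))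
∑∑-distrib-+ f g = trans (sum-cong-≗ λ x → ∑-distrib-+ (f x) (g x))
                         (∑-distrib-+ (λ x → ∑ (f x)) (λ x → ∑ (g x)))

∑-single : ∀ {n} (f : Fin n → ℕ) v → (∀ x → x ≢ v → f x ≡ 0) → ∑ f ≡ f v
∑-single {suc n} f v off = begin
  ∑ f                     ≡⟨ sum-remove {i = v} f ⟩
  f v + ∑ (f ∘ punchIn v) ≡⟨ cong (f v +_) (∑-zero (λ x → off _ (punchInᵢ≢i v x))) ⟩
  f v + 0                 ≡⟨ +-identityʳ (f v) ⟩
  f v                     ∎
  where open ≡-Reasoning

∑-pair : ∀ {n} (f : Fin n → ℕ) u v → u ≢ v → (∀ x → x ≢ u → x ≢ v → f x ≡ 0) →
  ∑ f ≡ f u + f v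
∑-pair {suc n} f u v u≢v off = begin
  ∑ f                                ≡⟨ sum-remove {i = u} f ⟩
  f u + ∑ (f ∘ punchIn u)            ≡⟨ cong (f u +_) (∑-single (f ∘ punchIn u) v′ off′) ⟩
  f u + f (punchIn u v′)             ≡⟨ cong (λ y → f u + f y) (punchIn-punchOut u≢v) ⟩
  f u + f v                          ∎
  where
  open ≡-Reasoning
  v′ : Fin n
  v′ = punchOut u≢v
  off′ : ∀ x → x ≢ v′ → f (punchIn u x) ≡ 0
  off′ x x≢v′ = off _ (punchInᵢ≢i u x)
    (λ eq → x≢v′ (punchIn-injective u x v′ (trans eq (sym (punchIn-punchOut u≢v)))))

infixl 6 _∪_
infixl 7 _∩_

_∪_ : ∀ {n} → VSet n → VSet n → VSet n
(A ∪ B) x = A x ∨ B x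

_∩_ : ∀ {n} → VSet n → VSet n → VSet n
(A ∩ B) x = A x ∧ B x

pairSet : ∀ {n} → Fin n → Fin n → VSet n
pairSet a b x = ⌊ x ≟ a ⌋ ∨ ⌊ x ≟ b ⌋

_－_ : ∀ {n} → VSet n → Fin n → VSet n
(A － v) x = A x ∧ not ⌊ x ≟ v ⌋

∩-absorb : ∀ {n} {S T : VSet n} → S ⊆ T → T ∩ S ≗ S
∩-absorb {S = S} {T} S⊆T x with S x in Sx
... | true  = cong (_∧ true) (S⊆T x Sx)
... | false = ∧-zeroʳ (T x)

∩⊆ : ∀ {n} (X S : VSet n) → (X ∩ S) ⊆ S
∩⊆ X S x X∩Sx = proj₂ (∧-true X∩Sx)

∩⊆ˡ : ∀ {n} (X S : VSet n) → (X ∩ S) ⊆ X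
∩⊆ˡ X S x X∩Sx = proj₁ (∧-true X∩Sx)

pairSet-cases : ∀ {n} (a b x : Fin n) → pairSet a b x ≡ true → x ≡ a ⊎ x ≡ b
pairSet-cases a b x x∈ with x ≟ a | x ≟ b
... | yes x≡a | _       = inj₁ x≡a
... | no _    | yes x≡b = inj₂ x≡b

pairSet-fst : ∀ {n} (a b : Fin n) → pairSet a b a ≡ true
pairSet-fst a b = cong (_∨ ⌊ a ≟ b ⌋) (≟-refl a)

pairSet-snd : ∀ {n} (a b : Fin n) → pairSet a b b ≡ true
pairSet-snd a b = trans (cong (⌊ b ≟ a ⌋ ∨_) (≟-refl b)) (∨-zeroʳ _)

pairSet-out : ∀ {n} {a b x : Fin n} → x ≢ a → x ≢ b → pairSet a b x ≡ false
pairSet-out x≢a x≢b rewrite ≟-≢ x≢a | ≟-≢ x≢b = refl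

pairSet-⊆ : ∀ {n} {a b : Fin n} {W : VSet n} → W a ≡ true → W b ≡ true → pairSet a b ⊆ W
pairSet-⊆ {a = a} {b} Wa Wb x x∈ with pairSet-cases a b x x∈
... | inj₁ refl = Wa
... | inj₂ refl = Wb

-- The weight of a vertex set under vertex weights w. Both |X| (weight 1) and i_L(X) (weight L)
-- are weights, so their congruence, monotonicity and modularity are proved once here.

only : Bool → ℕ → ℕ
only b k = if b then k else 0

weight : ∀ {n} → (Fin n → ℕ) → VSet n → ℕ
weight w X = ∑ λ x → only (X x) (w x)

card≡∑ : ∀ {n} (X : VSet n) → card X ≡ ∑ (λ x → b2n (X x))
card≡∑ X = sum-allFin (λ x → b2n (X x))

card≡weight : ∀ {n} (X : VSet n) → card X ≡ weight (λ _ → 1) X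
card≡weight X = trans (card≡∑ X) (sum-cong-≗ (λ x → b2n-if (X x)))
  where
  b2n-if : ∀ b → b2n b ≡ only b 1
  b2n-if true  = refl
  b2n-if false = refl

iL≡weight : ∀ {n} (G : LGraph n) X → iL G X ≡ weight (L G) X
iL≡weight G X = sum-allFin (λ x → only (X x) (L G x))

weight-cong : ∀ {n} (w : Fin n → ℕ) {X Y : VSet n} → X ≗ Y → weight w X ≡ weight w Y
weight-cong w X≗Y = sum-cong-≗ (λ x → cong (λ b → only b (w x)) (X≗Y x))

weight-congʷ : ∀ {n} {w w′ : Fin n → ℕ} → (∀ x → w x ≡ w′ x) → ∀ X → weight w X ≡ weight w′ X
weight-congʷ w≡w′ X = sum-cong-≗ (λ x → cong (only (X x)) (w≡w′ x))

weight-mono : ∀ {n} (w : Fin n → ℕ) {X Y : VSet n} → X ⊆ Y → weight w X ≤ weight w Y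
weight-mono w {X} {Y} X⊆Y = ∑-mono pointwise
  where
  pointwise : ∀ x → only (X x) (w x) ≤ only (Y x) (w x)
  pointwise x with X x in Xx
  ... | false = z≤n
  ... | true rewrite X⊆Y x Xx = ≤-refl

weight-mod : ∀ {n} (w : Fin n → ℕ) (A B : VSet n) →
  weight w (A ∪ B) + weight w (A ∩ B) ≡ weight w A + weight w B
weight-mod w A B = begin
  weight w (A ∪ B) + weight w (A ∩ B)     ≡⟨ ∑-distrib-+ (on (A ∪ B)) (on (A ∩ B)) ⟨
  ∑ (λ x → on (A ∪ B) x + on (A ∩ B) x)   ≡⟨ sum-cong-≗ (λ x → pointwise (A x) (B x) (w x)) ⟩
  ∑ (λ x → on A x + on B x)               ≡⟨ ∑-distrib-+ (on A) (on B) ⟩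
  weight w A + weight w B                 ∎
  where
  open ≡-Reasoning
  on : VSet _ → Fin _ → ℕ
  on X x = only (X x) (w x)
  pointwise : ∀ a b k → only (a ∨ b) k + only (a ∧ b) k ≡ only a k + only b k
  pointwise true  true  k = refl
  pointwise true  false k = refl
  pointwise false true  k = +-comm k 0
  pointwise false false k = refl

weight-agree : ∀ {n} (w : Fin n → ℕ) {A B : VSet n} → (∀ x → A x ≡ B x ⊎ w x ≡ 0) → weight w A ≡ weight w B
weight-agree w {A} {B} agree = sum-cong-≗ pointwise
  where
  pointwise : ∀ x → only (A x) (w x) ≡ only (B x) (w x)
  pointwise x with agree x
  ... | inj₁ Ax≡Bx = cong (λ c → only c (w x)) Ax≡Bx
  ... | inj₂ w≡0 with A x | B x
  ...   | true  | true  = refl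
  ...   | true  | false = w≡0
  ...   | false | true  = sym w≡0
  ...   | false | false = refl

weight-restrict : ∀ {n} (w : Fin n → ℕ) (S X : VSet n) → (∀ x → S x ≡ false → w x ≡ 0) →
  weight w X ≡ weight w (X ∩ S)
weight-restrict w S X off = weight-agree w agree
  where
  agree : ∀ x → X x ≡ (X x ∧ S x) ⊎ w x ≡ 0
  agree x with S x in Sx
  ... | true  = inj₁ (sym (∧-identityʳ (X x)))
  ... | false = inj₂ (off x Sx)

≗-dec : ∀ {n} (A B : VSet n) → Dec (A ≗ B)
≗-dec A B = all? (λ x → A x Bool.≟ B x)

card-cong : ∀ {n} {X Y : VSet n} → X ≗ Y → card X ≡ card Y
card-cong {X = X} {Y} X≗Y =
  trans (card≡weight X) (trans (weight-cong _ X≗Y) (sym (card≡weight Y)))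

card-mono : ∀ {n} {X Y : VSet n} → X ⊆ Y → card X ≤ card Y
card-mono {X = X} {Y} X⊆Y =
  subst₂ _≤_ (sym (card≡weight X)) (sym (card≡weight Y)) (weight-mono _ X⊆Y)

card-mod : ∀ {n} (A B : VSet n) → card (A ∪ B) + card (A ∩ B) ≡ card A + card B
card-mod A B = begin
  card (A ∪ B) + card (A ∩ B)               ≡⟨ cong₂ _+_ (card≡weight (A ∪ B)) (card≡weight (A ∩ B)) ⟩
  weight one (A ∪ B) + weight one (A ∩ B)   ≡⟨ weight-mod one A B ⟩
  weight one A + weight one B               ≡⟨ cong₂ _+_ (card≡weight A) (card≡weight B) ⟨
  card A + card B                           ∎
  where
  open ≡-Reasoning
  one : Fin _ → ℕ
  one _ = 1

-- There are only n vertices; bounds the depth of the search for paths.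
card≤n : ∀ {n} (X : VSet n) → card X ≤ n
card≤n {n} X = subst₂ _≤_ (sym (card≡∑ X)) (ones n) (∑-mono (λ x → b2n≤1 (X x)))
  where
  b2n≤1 : ∀ b → b2n b ≤ 1
  b2n≤1 true  = ≤-refl
  b2n≤1 false = z≤n
  ones : ∀ m → ∑ {m} (λ _ → 1) ≡ m
  ones zero    = refl
  ones (suc m) = cong suc (ones m)

card-∩pairSet : ∀ {n} (X : VSet n) {u v : Fin n} → u ≢ v →
  card (X ∩ pairSet u v) ≡ b2n (X u) + b2n (X v)
card-∩pairSet X {u} {v} u≢v = begin
  card (X ∩ pairSet u v)  ≡⟨ card≡∑ (X ∩ pairSet u v) ⟩
  ∑ f                     ≡⟨ ∑-pair f u v u≢v off ⟩
  f u + f v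
    ≡⟨ cong₂ (λ p q → b2n (X u ∧ p) + b2n (X v ∧ q)) (pairSet-fst u v) (pairSet-snd u v) ⟩
  b2n (X u ∧ true) + b2n (X v ∧ true)
    ≡⟨ cong₂ (λ p q → b2n p + b2n q) (∧-identityʳ (X u)) (∧-identityʳ (X v)) ⟩
  b2n (X u) + b2n (X v)   ∎
  where
  open ≡-Reasoning
  f : Fin _ → ℕ
  f x = b2n (X x ∧ pairSet u v x)
  off : ∀ x → x ≢ u → x ≢ v → f x ≡ 0
  off x x≢u x≢v rewrite pairSet-out x≢u x≢v = cong b2n (∧-zeroʳ (X x))

card-pairSet : ∀ {n} {u v : Fin n} → u ≢ v → card (pairSet u v) ≡ 2
card-pairSet u≢v = card-∩pairSet (λ _ → true) u≢v

card-two : ∀ {n} {W : VSet n} {x y : Fin n} → x ≢ y → W x ≡ true → W y ≡ true → 2 ≤ card W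
card-two {W = W} x≢y Wx Wy = subst (_≤ card W) (card-pairSet x≢y) (card-mono {Y = W} (pairSet-⊆ Wx Wy))

card-member : ∀ {n} {W : VSet n} {x : Fin n} → W x ≡ true → 1 ≤ card W
card-member {W = W} {x} Wx = subst₂ _≤_ (cong b2n Wx) (sym (card≡∑ W)) (∑-term (λ y → b2n (W y)) x)

card≤1-unique : ∀ {n} {W : VSet n} → card W ≤ 1 → ∀ {x y} → W x ≡ true → W y ≡ true → x ≡ y
card≤1-unique {W = W} small {x} {y} Wx Wy with x ≟ y
... | yes x≡y = x≡y
... | no x≢y  = ⊥-elim (<-irrefl refl (≤-trans (card-two x≢y Wx Wy) small))

card-remove : ∀ {n} (A : VSet n) {v : Fin n} → A v ≡ true → card A ≡ suc (card (A － v))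
card-remove A {v} Av = begin
  card A                           ≡⟨ card≡∑ A ⟩
  ∑ (λ x → b2n (A x))              ≡⟨ sum-cong-≗ split ⟩
  ∑ (λ x → b2n ((A － v) x) + δ x) ≡⟨ ∑-distrib-+ (λ x → b2n ((A － v) x)) δ ⟩
  ∑ (λ x → b2n ((A － v) x)) + ∑ δ ≡⟨ cong₂ _+_ (sym (card≡∑ (A － v))) (∑-single δ v δ-off) ⟩
  card (A － v) + δ v              ≡⟨ cong (λ b → card (A － v) + b2n b) (≟-refl v) ⟩
  card (A － v) + 1                ≡⟨ +-comm (card (A － v)) 1 ⟩
  suc (card (A － v))              ∎
  where
  open ≡-Reasoning
  δ : Fin _ → ℕ
  δ x = b2n ⌊ x ≟ v ⌋
  δ-off : ∀ x → x ≢ v → δ x ≡ 0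
  δ-off x x≢v = cong b2n (≟-≢ x≢v)
  split : ∀ x → b2n (A x) ≡ b2n ((A － v) x) + δ x
  split x with x ≟ v
  ... | yes refl rewrite Av = refl
  ... | no _ = sym (trans (+-identityʳ _) (cong b2n (∧-identityʳ (A x))))

member : ∀ {n} (X : VSet n) {k} → card X ≡ suc k → ∃[ x ] X x ≡ true
member X {k} cX with any? (λ x → X x Bool.≟ true)
... | yes found = found
... | no none   = ⊥-elim (0≢1+n (trans (sym empty) cX))
  where
  empty : card X ≡ 0
  empty = trans (card≡∑ X) (∑-zero absent)
    where
    absent : ∀ x → b2n (X x) ≡ 0
    absent x with X x in Xx
    ... | false = refl
    ... | true  = ⊥-elim (none (x , Xx))

card≡0-absent : ∀ {n} {X : VSet n} → card X ≡ 0 → ∀ x → X x ≡ false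
card≡0-absent {X = X} c₀ x with X x in Xx
... | false = refl
... | true  = ⊥-elim (<-irrefl refl (subst (1 ≤_) c₀ (card-member {W = X} Xx)))

card≡2 : ∀ {n} (X : VSet n) → card X ≡ 2 → ∃[ a ] ∃[ b ] (a ≢ b × X ≗ pairSet a b)
card≡2 X c₂ = let (a , Xa) = member X c₂
                  c₁ = suc-injective (trans (sym (card-remove X Xa)) c₂)
                  (b , X－a∋b) = member (X － a) c₁
                  c₀ = suc-injective (trans (sym (card-remove (X － a) X－a∋b)) c₁)
              in a , b , exhaust Xa X－a∋b (card≡0-absent c₀)
  where
  exhaust : ∀ {a b} → X a ≡ true → (X － a) b ≡ true → (∀ x → ((X － a) － b) x ≡ false) →
            a ≢ b × X ≗ pairSet a b
  exhaust {a} {b} Xa X－a∋b rest = a≢b , same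
    where
    Xb : X b ≡ true
    Xb = proj₁ (∧-true X－a∋b)
    a≢b : a ≢ b
    a≢b refl = true≢false (trans (sym (proj₂ (∧-true X－a∋b))) (cong not (≟-refl a)))
    same : X ≗ pairSet a b
    same x with x ≟ a | x ≟ b
    ... | yes refl | _        = Xa
    ... | no _     | yes refl = Xb
    ... | no x≢a   | no x≢b   = trans (sym (trans (cong₂ (λ p q → (X x ∧ not p) ∧ not q) (≟-≢ x≢a) (≟-≢ x≢b))
                                           (trans (∧-identityʳ _) (∧-identityʳ _))))
                                       (rest x)

-- A symmetric relation P is counted once per unordered pair, on the strict
-- upper triangle x < y (below P); pairs R X adds the pair weights R x y over the pairs of X.

below : ∀ {n} → (Fin n → Fin n → Bool) → Fin n → Fin n → ℕ
below P x y = b2n (⌊ toℕ x <? toℕ y ⌋ ∧ P x y)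

below-diag : ∀ {n} (P : Fin n → Fin n → Bool) x → below P x x ≡ 0
below-diag P x with toℕ x <? toℕ x
... | yes x<x = ⊥-elim (<-irrefl refl x<x)
... | no _    = refl

below-absent : ∀ {n} (P : Fin n → Fin n → Bool) {x y} → P x y ≡ false → below P x y ≡ 0
below-absent P {x} {y} off = cong b2n (trans (cong (⌊ toℕ x <? toℕ y ⌋ ∧_) off) (∧-zeroʳ _))

pairs : ∀ {n} → (Fin n → Fin n → ℕ) → VSet n → ℕ
pairs R X = ∑ λ x → ∑ λ y → b2n (X x ∧ X y) * R x y

iE≡pairs : ∀ {n} (G : LGraph n) X → iE G X ≡ pairs (below (E G)) X
iE≡pairs {n} G X = trans (sum-allFin (λ x → sum (map (edge x) (allFin n))))
  (sum-cong-≗ λ x → trans (sum-allFin (edge x)) (sum-cong-≗ λ y →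
    factor ⌊ toℕ x <? toℕ y ⌋ (X x) (X y) (E G x y)))
  where
  edge : Fin n → Fin n → ℕ
  edge x y = b2n (⌊ toℕ x <? toℕ y ⌋ ∧ X x ∧ X y ∧ E G x y)
  factor : ∀ l a b e → b2n (l ∧ a ∧ b ∧ e) ≡ b2n (a ∧ b) * b2n (l ∧ e)
  factor false a     b     e = sym (*-zeroʳ (b2n (a ∧ b)))
  factor true  false b     e = refl
  factor true  true  false e = refl
  factor true  true  true  e = sym (+-identityʳ (b2n e))

pairs-cong : ∀ {n} (R : Fin n → Fin n → ℕ) {X Y : VSet n} → X ≗ Y → pairs R X ≡ pairs R Y
pairs-cong R X≗Y = sum-cong-≗ λ x → sum-cong-≗ λ y →
  cong₂ (λ p q → b2n (p ∧ q) * R x y) (X≗Y x) (X≗Y y)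

pairs-congʷ : ∀ {n} {R S : Fin n → Fin n → ℕ} X → (∀ x y → X x ≡ true → X y ≡ true → R x y ≡ S x y) →
  pairs R X ≡ pairs S X
pairs-congʷ {R = R} {S} X R≡S = sum-cong-≗ λ x → sum-cong-≗ λ y → pointwise x y
  where
  pointwise : ∀ x y → b2n (X x ∧ X y) * R x y ≡ b2n (X x ∧ X y) * S x y
  pointwise x y with X x in Xx | X y in Xy
  ... | false | _     = refl
  ... | true  | false = refl
  ... | true  | true  = cong (_+ 0) (R≡S x y Xx Xy)

pairs-+ : ∀ {n} (R S : Fin n → Fin n → ℕ) X →
  pairs (λ x y → R x y + S x y) X ≡ pairs R X + pairs S X
pairs-+ R S X = trans
  (sum-cong-≗ λ x → sum-cong-≗ λ y → *-distribˡ-+ (b2n (X x ∧ X y)) (R x y) (S x y))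
  (∑∑-distrib-+ (λ x y → b2n (X x ∧ X y) * R x y) (λ x y → b2n (X x ∧ X y) * S x y))

pairs-mono : ∀ {n} {R S : Fin n → Fin n → ℕ} X →
  (∀ x y → X x ≡ true → X y ≡ true → R x y ≤ S x y) → pairs R X ≤ pairs S X
pairs-mono X R≤S = ∑-mono λ x → ∑-mono λ y → pointwise x y
  where
  pointwise : ∀ x y → b2n (X x ∧ X y) * _ ≤ b2n (X x ∧ X y) * _
  pointwise x y with X x in Xx | X y in Xy
  ... | false | _     = z≤n
  ... | true  | false = z≤n
  ... | true  | true  = +-monoˡ-≤ 0 (R≤S x y Xx Xy)

both-zero : ∀ a b {r} → r ≡ 0 → a * r ≡ b * r
both-zero a b refl = trans (*-zeroʳ a) (sym (*-zeroʳ b))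

pairs-restrict : ∀ {n} (R : Fin n → Fin n → ℕ) (S X : VSet n) →
  (∀ x y → (S x ∧ S y) ≡ false → R x y ≡ 0) → pairs R X ≡ pairs R (X ∩ S)
pairs-restrict R S X off = sum-cong-≗ λ x → sum-cong-≗ λ y → pointwise x y
  where
  pointwise : ∀ x y → b2n (X x ∧ X y) * R x y ≡ b2n ((X x ∧ S x) ∧ (X y ∧ S y)) * R x y
  pointwise x y with S x in Sx | S y in Sy
  ... | true  | true  =
    cong₂ (λ p q → b2n (p ∧ q) * R x y) (sym (∧-identityʳ (X x))) (sym (∧-identityʳ (X y)))
  ... | false | Sy′   =
    both-zero (b2n (X x ∧ X y)) (b2n ((X x ∧ false) ∧ (X y ∧ Sy′))) (off x y (cong₂ _∧_ Sx Sy))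
  ... | true  | false =
    both-zero (b2n (X x ∧ X y)) (b2n ((X x ∧ true) ∧ (X y ∧ false))) (off x y (cong₂ _∧_ Sx Sy))

pairs-small : ∀ {n} (R : Fin n → Fin n → ℕ) {X : VSet n} → card X ≤ 1 → (∀ x → R x x ≡ 0) →
  pairs R X ≡ 0
pairs-small R {X} small diag = ∑-zero λ x → ∑-zero λ y → pointwise x y
  where
  pointwise : ∀ x y → b2n (X x ∧ X y) * R x y ≡ 0
  pointwise x y with X x in Xx | X y in Xy
  ... | false | _     = refl
  ... | true  | false = refl
  ... | true  | true  with card≤1-unique small {x} {y} Xx Xy
  ...   | refl = trans (+-identityʳ (R x x)) (diag x)

-- The indicator of "xy ⊆ X" is modular in X, except on pairs crossing between A ∖ B and B ∖ A.
pair-modular : ∀ ax bx ay by →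
  (b2n ((ax ∨ bx) ∧ (ay ∨ by)) + b2n ((ax ∧ bx) ∧ (ay ∧ by)) ≡ b2n (ax ∧ ay) + b2n (bx ∧ by))
  ⊎ ((ax ≡ true × bx ≡ false × by ≡ true × ay ≡ false)
     ⊎ (bx ≡ true × ax ≡ false × ay ≡ true × by ≡ false))
pair-modular true  true  true  true  = inj₁ refl
pair-modular true  true  true  false = inj₁ refl
pair-modular true  true  false true  = inj₁ refl
pair-modular true  true  false false = inj₁ refl
pair-modular true  false true  _     = inj₁ refl
pair-modular true  false false true  = inj₂ (inj₁ (refl , refl , refl , refl))
pair-modular true  false false false = inj₁ refl
pair-modular false true  true  true  = inj₁ refl
pair-modular false true  true  false = inj₂ (inj₂ (refl , refl , refl , refl))
pair-modular false true  false true  = inj₁ refl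
pair-modular false true  false false = inj₁ refl
pair-modular false false _     _     = inj₁ refl

Separated : ∀ {n} → (Fin n → Fin n → ℕ) → VSet n → VSet n → Set
Separated R A B = ∀ x y → A x ≡ true → B x ≡ false → B y ≡ true → A y ≡ false → R x y ≡ 0 × R y x ≡ 0

pairs-mod : ∀ {n} (R : Fin n → Fin n → ℕ) (A B : VSet n) → Separated R A B →
  pairs R (A ∪ B) + pairs R (A ∩ B) ≡ pairs R A + pairs R B
pairs-mod R A B sep = begin
  pairs R (A ∪ B) + pairs R (A ∩ B)  ≡⟨ ∑∑-distrib-+ (inside (A ∪ B)) (inside (A ∩ B)) ⟨
  ∑ (λ x → ∑ λ y → inside (A ∪ B) x y + inside (A ∩ B) x y)
    ≡⟨ sum-cong-≗ (λ x → sum-cong-≗ (pointwise x)) ⟩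
  ∑ (λ x → ∑ λ y → inside A x y + inside B x y)  ≡⟨ ∑∑-distrib-+ (inside A) (inside B) ⟩
  pairs R A + pairs R B              ∎
  where
  open ≡-Reasoning
  inside : VSet _ → Fin _ → Fin _ → ℕ
  inside X x y = b2n (X x ∧ X y) * R x y
  all-zero : ∀ {x y} → R x y ≡ 0 →
    inside (A ∪ B) x y + inside (A ∩ B) x y ≡ inside A x y + inside B x y
  all-zero {x} {y} r≡0 =
    cong₂ _+_ (both-zero (b2n ((A x ∨ B x) ∧ (A y ∨ B y))) (b2n (A x ∧ A y)) r≡0)
              (both-zero (b2n ((A x ∧ B x) ∧ (A y ∧ B y))) (b2n (B x ∧ B y)) r≡0)
  pointwise : ∀ x y → inside (A ∪ B) x y + inside (A ∩ B) x y ≡ inside A x y + inside B x y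
  pointwise x y with pair-modular (A x) (B x) (A y) (B y)
  ... | inj₁ eq = trans
    (sym (*-distribʳ-+ (R x y) (b2n ((A x ∨ B x) ∧ (A y ∨ B y))) (b2n ((A x ∧ B x) ∧ (A y ∧ B y)))))
    (trans (cong (_* R x y) eq) (*-distribʳ-+ (R x y) (b2n (A x ∧ A y)) (b2n (B x ∧ B y))))
  ... | inj₂ (inj₁ (Ax , Bx , By , Ay)) = all-zero (proj₁ (sep x y Ax Bx By Ay))
  ... | inj₂ (inj₂ (Bx , Ax , Ay , By)) = all-zero (proj₂ (sep y x Ay By Bx Ax))

-- joins u v x y: the pair xy is the pair uv (this is the relation used in IsTwoSum).
joins : ∀ {n} → Fin n → Fin n → Fin n → Fin n → Bool
joins u v x y = (⌊ x ≟ u ⌋ ∧ ⌊ y ≟ v ⌋) ∨ (⌊ x ≟ v ⌋ ∧ ⌊ y ≟ u ⌋)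

joins-cases : ∀ {n} (u v x y : Fin n) → joins u v x y ≡ true → (x ≡ u × y ≡ v) ⊎ (x ≡ v × y ≡ u)
joins-cases u v x y xy=uv with x ≟ u | y ≟ v | x ≟ v | y ≟ u
... | yes x≡u | yes y≡v | _       | _       = inj₁ (x≡u , y≡v)
... | yes _   | no _    | yes x≡v | yes y≡u = inj₂ (x≡v , y≡u)
... | no _    | _       | yes x≡v | yes y≡u = inj₂ (x≡v , y≡u)

joins-off : ∀ {n} {u v x : Fin n} y → x ≢ u → x ≢ v → joins u v x y ≡ false
joins-off y x≢u x≢v rewrite ≟-≢ x≢u | ≟-≢ x≢v = refl

joins-flip : ∀ {n} (u v x y : Fin n) → joins u v x y ≡ joins v u x y
joins-flip u v x y = Bool.∨-comm (⌊ x ≟ u ⌋ ∧ ⌊ y ≟ v ⌋) (⌊ x ≟ v ⌋ ∧ ⌊ y ≟ u ⌋)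

joins-from : ∀ {n} {u v : Fin n} → u ≢ v → ∀ y → joins u v u y ≡ ⌊ y ≟ v ⌋
joins-from {u = u} u≢v y rewrite ≟-refl u | ≟-≢ u≢v = ∨-identityʳ _

joins-sym : ∀ {n} (u v x y : Fin n) → joins u v x y ≡ joins u v y x
joins-sym u v x y = trans (Bool.∨-comm (⌊ x ≟ u ⌋ ∧ ⌊ y ≟ v ⌋) (⌊ x ≟ v ⌋ ∧ ⌊ y ≟ u ⌋))
  (cong₂ _∨_ (Bool.∧-comm ⌊ x ≟ v ⌋ ⌊ y ≟ u ⌋) (Bool.∧-comm ⌊ x ≟ u ⌋ ⌊ y ≟ v ⌋))

joins-diag : ∀ {n} {u v : Fin n} → u ≢ v → ∀ x → joins u v x x ≡ false
joins-diag {u = u} {v} u≢v x = false-if-not-true λ xx=uv → case (joins-cases u v x x xx=uv)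
  where
  case : (x ≡ u × x ≡ v) ⊎ (x ≡ v × x ≡ u) → ⊥
  case (inj₁ (refl , refl)) = u≢v refl
  case (inj₂ (refl , refl)) = u≢v refl

joins-ends : ∀ {n} {u v x y : Fin n} → u ≢ v → pairSet u v x ≡ true → pairSet u v y ≡ true → x ≢ y →
  joins u v x y ≡ true
joins-ends {u = u} {v} {x} {y} u≢v x∈ y∈ x≢y with pairSet-cases u v x x∈ | pairSet-cases u v y y∈
... | inj₁ refl | inj₁ refl = ⊥-elim (x≢y refl)
... | inj₂ refl | inj₂ refl = ⊥-elim (x≢y refl)
... | inj₁ refl | inj₂ refl = trans (joins-from u≢v v) (≟-refl v)
... | inj₂ refl | inj₁ refl = trans (joins-flip u v v u) (trans (joins-from (u≢v ∘ sym) u) (≟-refl u))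

<-exactly-one : ∀ {n} {u v : Fin n} → u ≢ v → b2n ⌊ toℕ u <? toℕ v ⌋ + b2n ⌊ toℕ v <? toℕ u ⌋ ≡ 1
<-exactly-one {u = u} {v} u≢v with toℕ u <? toℕ v | toℕ v <? toℕ u
... | yes u<v | yes v<u = ⊥-elim (<-asym u<v v<u)
... | yes _   | no _    = refl
... | no _    | yes _   = refl
... | no u≮v  | no v≮u  = ⊥-elim (u≢v (toℕ-injective (≤-antisym (≮⇒≥ v≮u) (≮⇒≥ u≮v))))

pairs-joins : ∀ {n} {u v : Fin n} → u ≢ v → ∀ X → pairs (below (joins u v)) X ≡ b2n (X u ∧ X v)
pairs-joins {n} {u} {v} u≢v X = begin
  pairs (below (joins u v)) X  ≡⟨ ∑-pair (row (joins u v)) u v u≢v row-off ⟩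
  row (joins u v) u + row (joins u v) v
    ≡⟨ cong₂ _+_ (row-at u≢v (joins u v) (λ _ → refl))
                 (row-at (u≢v ∘ sym) (joins u v) (joins-flip u v v)) ⟩
  b2n (X u ∧ X v) * b2n ⌊ toℕ u <? toℕ v ⌋ + b2n (X v ∧ X u) * b2n ⌊ toℕ v <? toℕ u ⌋
    ≡⟨ cong (λ c → b2n (X u ∧ X v) * _ + b2n c * _) (Bool.∧-comm (X v) (X u)) ⟩
  b2n (X u ∧ X v) * b2n ⌊ toℕ u <? toℕ v ⌋ + b2n (X u ∧ X v) * b2n ⌊ toℕ v <? toℕ u ⌋
    ≡⟨ *-distribˡ-+ (b2n (X u ∧ X v)) _ _ ⟨
  b2n (X u ∧ X v) * (b2n ⌊ toℕ u <? toℕ v ⌋ + b2n ⌊ toℕ v <? toℕ u ⌋)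
    ≡⟨ cong (b2n (X u ∧ X v) *_) (<-exactly-one u≢v) ⟩
  b2n (X u ∧ X v) * 1          ≡⟨ *-identityʳ _ ⟩
  b2n (X u ∧ X v)              ∎
  where
  open ≡-Reasoning
  row : (Fin n → Fin n → Bool) → Fin n → ℕ
  row P x = ∑ λ y → b2n (X x ∧ X y) * below P x y
  vanish : ∀ {P : Fin n → Fin n → Bool} x y → P x y ≡ false → b2n (X x ∧ X y) * below P x y ≡ 0
  vanish {P} x y off = trans (cong (b2n (X x ∧ X y) *_) (below-absent P off)) (*-zeroʳ (b2n (X x ∧ X y)))
  row-off : ∀ x → x ≢ u → x ≢ v → row (joins u v) x ≡ 0
  row-off x x≢u x≢v = ∑-zero λ y → vanish {joins u v} x y (joins-off y x≢u x≢v)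
  row-at : ∀ {a b} → a ≢ b → ∀ P → (∀ y → P a y ≡ joins a b a y) →
    row P a ≡ b2n (X a ∧ X b) * b2n ⌊ toℕ a <? toℕ b ⌋
  row-at {a} {b} a≢b P P≡ = begin
    row P a                                            ≡⟨ ∑-single _ b off-b ⟩
    b2n (X a ∧ X b) * b2n (⌊ toℕ a <? toℕ b ⌋ ∧ P a b) ≡⟨ cong (λ c → ends * b2n (a<b ∧ c)) Pab ⟩
    b2n (X a ∧ X b) * b2n (⌊ toℕ a <? toℕ b ⌋ ∧ true)  ≡⟨ cong (λ c → ends * b2n c) (∧-identityʳ a<b) ⟩
    b2n (X a ∧ X b) * b2n ⌊ toℕ a <? toℕ b ⌋           ∎
    where
    ends : ℕ
    ends = b2n (X a ∧ X b)
    a<b : Bool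
    a<b = ⌊ toℕ a <? toℕ b ⌋
    off-b : ∀ y → y ≢ b → b2n (X a ∧ X y) * below P a y ≡ 0
    off-b y y≢b = vanish {P} a y (trans (P≡ y) (trans (joins-from a≢b y) (≟-≢ y≢b)))
    Pab : P a b ≡ true
    Pab = trans (P≡ b) (trans (joins-from a≢b b) (≟-refl b))

iE-cong : ∀ {n} (G : LGraph n) {X Y : VSet n} → X ≗ Y → iE G X ≡ iE G Y
iE-cong G {X} {Y} X≗Y = trans (iE≡pairs G X) (trans (pairs-cong _ X≗Y) (sym (iE≡pairs G Y)))

iL-cong : ∀ {n} (G : LGraph n) {X Y : VSet n} → X ≗ Y → iL G X ≡ iL G Y
iL-cong G {X} {Y} X≗Y = trans (iL≡weight G X) (trans (weight-cong _ X≗Y) (sym (iL≡weight G Y)))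

NoEdgeBetween : ∀ {n} → LGraph n → VSet n → VSet n → Set
NoEdgeBetween G A B = ∀ x y → E G x y ≡ true → A x ≡ true → B x ≡ false → B y ≡ true → A y ≡ false → ⊥

iE-mod : ∀ {n} (G : LGraph n) (A B : VSet n) → NoEdgeBetween G A B →
  iE G (A ∪ B) + iE G (A ∩ B) ≡ iE G A + iE G B
iE-mod G A B apart = begin
  iE G (A ∪ B) + iE G (A ∩ B)  ≡⟨ cong₂ _+_ (iE≡pairs G (A ∪ B)) (iE≡pairs G (A ∩ B)) ⟩
  pairs (below (E G)) (A ∪ B) + pairs (below (E G)) (A ∩ B)  ≡⟨ pairs-mod _ A B separated ⟩
  pairs (below (E G)) A + pairs (below (E G)) B              ≡⟨ cong₂ _+_ (iE≡pairs G A) (iE≡pairs G B) ⟨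
  iE G A + iE G B              ∎
  where
  open ≡-Reasoning
  separated : Separated (below (E G)) A B
  separated x y Ax Bx By Ay =
    below-absent (E G) (false-if-not-true λ e → apart x y e Ax Bx By Ay) ,
    below-absent (E G) (false-if-not-true λ e → apart x y (trans (E-sym G x y) e) Ax Bx By Ay)

iL-mod : ∀ {n} (G : LGraph n) (A B : VSet n) → iL G (A ∪ B) + iL G (A ∩ B) ≡ iL G A + iL G B
iL-mod G A B = begin
  iL G (A ∪ B) + iL G (A ∩ B)  ≡⟨ cong₂ _+_ (iL≡weight G (A ∪ B)) (iL≡weight G (A ∩ B)) ⟩
  weight (L G) (A ∪ B) + weight (L G) (A ∩ B)  ≡⟨ weight-mod (L G) A B ⟩
  weight (L G) A + weight (L G) B              ≡⟨ cong₂ _+_ (iL≡weight G A) (iL≡weight G B) ⟨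
  iL G A + iL G B              ∎
  where open ≡-Reasoning

iE-restrict : ∀ {n} (G : LGraph n) X → iE G X ≡ iE G (X ∩ V G)
iE-restrict G X = begin
  iE G X                              ≡⟨ iE≡pairs G X ⟩
  pairs (below (E G)) X               ≡⟨ pairs-restrict _ (V G) X off ⟩
  pairs (below (E G)) (X ∩ V G)       ≡⟨ iE≡pairs G (X ∩ V G) ⟨
  iE G (X ∩ V G)                      ∎
  where
  open ≡-Reasoning
  off : ∀ x y → (V G x ∧ V G y) ≡ false → below (E G) x y ≡ 0
  off x y outside = below-absent (E G) (false-if-not-true λ e →
    true≢false (trans (sym (cong₂ _∧_ (E-V G x y e) (E-V G y x (trans (E-sym G y x) e)))) outside))

iL-restrict : ∀ {n} (G : LGraph n) X → iL G X ≡ iL G (X ∩ V G)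
iL-restrict G X = trans (iL≡weight G X)
  (trans (weight-restrict (L G) (V G) X (L-V G)) (sym (iL≡weight G (X ∩ V G))))

iE-small : ∀ {n} (G : LGraph n) {X : VSet n} → card X ≤ 1 → iE G X ≡ 0
iE-small G {X} small = trans (iE≡pairs G X) (pairs-small _ small (below-diag (E G)))

pairs-term : ∀ {n} (R : Fin n → Fin n → ℕ) X x y → b2n (X x ∧ X y) * R x y ≤ pairs R X
pairs-term R X x y = ≤-trans (∑-term (λ y → b2n (X x ∧ X y) * R x y) y)
                             (∑-term (λ x → ∑ λ y → b2n (X x ∧ X y) * R x y) x)

no-edge-inside : ∀ {n} (G : LGraph n) {X : VSet n} → iE G X ≡ 0 →
  ∀ {x y} → X x ≡ true → X y ≡ true → E G x y ≡ false
no-edge-inside G {X} none {x} {y} Xx Xy with E G x y in e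
... | false = refl
... | true  = ⊥-elim (0≢1+n (begin
      0                                          ≡⟨ cong₂ _+_ (absent x y Xx Xy) (absent y x Xy Xx) ⟨
      below (E G) x y + below (E G) y x
        ≡⟨ cong₂ _+_ (present x y e) (present y x (trans (E-sym G y x) e)) ⟩
      b2n ⌊ toℕ x <? toℕ y ⌋ + b2n ⌊ toℕ y <? toℕ x ⌋ ≡⟨ <-exactly-one x≢y ⟩
      1                                          ∎))
  where
  open ≡-Reasoning
  x≢y : x ≢ y
  x≢y refl = true≢false (trans (sym e) (E-irr G x))
  present : ∀ p q → E G p q ≡ true → below (E G) p q ≡ b2n ⌊ toℕ p <? toℕ q ⌋
  present p q epq = cong b2n (trans (cong (⌊ toℕ p <? toℕ q ⌋ ∧_) epq) (∧-identityʳ _))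
  absent : ∀ p q → X p ≡ true → X q ≡ true → below (E G) p q ≡ 0
  absent p q Xp Xq = n≤0⇒n≡0 (subst₂ _≤_ (trans (cong (λ c → b2n c * below (E G) p q) (cong₂ _∧_ Xp Xq))
                                                 (+-identityʳ _))
                                          (trans (sym (iE≡pairs G X)) none)
                                          (pairs-term (below (E G)) X p q))

∪-⊆ : ∀ {n} {A B S : VSet n} → A ⊆ S → B ⊆ S → (A ∪ B) ⊆ S
∪-⊆ {A = A} A⊆S B⊆S x A∪Bx with ∨-true {A x} A∪Bx
... | inj₁ Ax = A⊆S x Ax
... | inj₂ Bx = B⊆S x Bx

⊊-witness : ∀ {n} {W S : VSet n} → W ⊆ S → ¬ (W ≗ S) → ∃[ z ] (W z ≡ false × S z ≡ true)
⊊-witness {W = W} {S} W⊆S W≉S with any? (λ z → (W z Bool.≟ false) ×-dec (S z Bool.≟ true))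
... | yes found = found
... | no none   = ⊥-elim (W≉S same)
  where
  same : W ≗ S
  same z with W z in Wz | S z in Sz
  ... | true  | true  = refl
  ... | false | false = refl
  ... | true  | false = true≢false (trans (sym (W⊆S z Wz)) Sz)
  ... | false | true  = ⊥-elim (none (z , Wz , Sz))

squeeze : ∀ {n} {X W S T : VSet n} → X ⊆ W → W ⊆ S → S ∩ T ≗ X → W ∩ T ≗ X
squeeze {X = X} {W} {S} {T} X⊆W W⊆S S∩T≗X x with W x in Wx | X x in Xx
... | true  | _     = trans (cong (_∧ T x) (sym (W⊆S x Wx))) (trans (S∩T≗X x) Xx)
... | false | false = refl
... | false | true  = true≢false (trans (sym (X⊆W x Xx)) Wx)

NoEdgeBetween-sym : ∀ {n} (G : LGraph n) {A B : VSet n} → NoEdgeBetween G A B → NoEdgeBetween G B A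
NoEdgeBetween-sym G apart x y e Bx Ax Ay By = apart y x (trans (E-sym G y x) e) Ay By Bx Ax

NoEdgeBetween-shrink : ∀ {n} (G : LGraph n) {S T W : VSet n} → NoEdgeBetween G S T →
  W ⊆ S → (S ∩ T) ⊆ W → NoEdgeBetween G W T
NoEdgeBetween-shrink G {S} {T} {W} apart W⊆S S∩T⊆W x y e Wx Tx Ty Wy =
  apart x y e (W⊆S x Wx) Tx Ty Sy
  where
  Sy : S y ≡ false
  Sy = false-if-not-true λ Sy′ → true≢false (trans (sym (S∩T⊆W y (cong₂ _∧_ Sy′ Ty))) Wy)

-- For a set, a = edges (+ loops), c = vertices; the pieces are
-- glued along k shared elements. All quantities are passed explicitly, since they occur under
-- 2 * _ and _ + _, where they cannot be inferred.

≱2⇒≤1 : ∀ {c} → ¬ 2 ≤ c → c ≤ 1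
≱2⇒≤1 2≰c = ≤-pred (≰⇒> 2≰c)

+0-intro : ∀ {a b} → a ≤ b → a + 0 ≤ b
+0-intro {a} a≤b = subst (_≤ _) (sym (+-identityʳ a)) a≤b

+0-elim : ∀ {a b} → a + 0 ≤ b → a ≤ b
+0-elim {a} a≤b = subst (_≤ _) (+-identityʳ a) a≤b

glue-bounds : ∀ a a₁ a₂ c c₁ c₂ {k m s₁ s₂} t₁ t₂ s →
  a + k ≡ a₁ + a₂ → c₁ + c₂ ≤ c + m →
  a₁ + s₁ ≤ t₁ + 2 * c₁ → a₂ + s₂ ≤ t₂ + 2 * c₂ →
  2 * m + (t₁ + t₂) + s ≤ k + (s₁ + s₂) →
  a + s ≤ 2 * c
glue-bounds a a₁ a₂ c c₁ c₂ {k} {m} {s₁} {s₂} t₁ t₂ s a-glue c-glue bound₁ bound₂ margin =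
  +-cancelʳ-≤ (2 * m + (t₁ + t₂)) (a + s) (2 * c) (begin
    a + s + (2 * m + (t₁ + t₂))     ≡⟨ lemma₁ a s m t₁ t₂ ⟩
    a + (2 * m + (t₁ + t₂) + s)     ≤⟨ +-monoʳ-≤ a margin ⟩
    a + (k + (s₁ + s₂))             ≡⟨ lemma₂ a k s₁ s₂ ⟩
    (a + k) + s₁ + s₂               ≡⟨ cong (λ x → x + s₁ + s₂) a-glue ⟩
    (a₁ + a₂) + s₁ + s₂             ≡⟨ lemma₃ a₁ a₂ s₁ s₂ ⟩
    (a₁ + s₁) + (a₂ + s₂)           ≤⟨ +-mono-≤ bound₁ bound₂ ⟩
    (t₁ + 2 * c₁) + (t₂ + 2 * c₂)   ≡⟨ lemma₄ c₁ c₂ t₁ t₂ ⟩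
    2 * (c₁ + c₂) + (t₁ + t₂)       ≤⟨ +-monoˡ-≤ (t₁ + t₂) (*-monoʳ-≤ 2 c-glue) ⟩
    2 * (c + m) + (t₁ + t₂)         ≡⟨ lemma₅ c m t₁ t₂ ⟩
    2 * c + (2 * m + (t₁ + t₂))     ∎)
  where
  open ≤-Reasoning
  lemma₁ : ∀ a s m t₁ t₂ → a + s + (2 * m + (t₁ + t₂)) ≡ a + (2 * m + (t₁ + t₂) + s)
  lemma₁ = solve-∀
  lemma₂ : ∀ a k s₁ s₂ → a + (k + (s₁ + s₂)) ≡ (a + k) + s₁ + s₂
  lemma₂ = solve-∀
  lemma₃ : ∀ a₁ a₂ s₁ s₂ → (a₁ + a₂) + s₁ + s₂ ≡ (a₁ + s₁) + (a₂ + s₂)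
  lemma₃ = solve-∀
  lemma₄ : ∀ c₁ c₂ t₁ t₂ → (t₁ + 2 * c₁) + (t₂ + 2 * c₂) ≡ 2 * (c₁ + c₂) + (t₁ + t₂)
  lemma₄ = solve-∀
  lemma₅ : ∀ c m t₁ t₂ → 2 * (c + m) + (t₁ + t₂) ≡ 2 * c + (2 * m + (t₁ + t₂))
  lemma₅ = solve-∀

glue-count : ∀ a a₁ a₂ c c₁ c₂ →
  a + 2 ≡ a₁ + a₂ → c + 2 ≡ c₁ + c₂ → a₁ ≡ 2 * c₁ + 1 → a₂ + 2 ≡ 2 * c₂ → a ≡ 2 * c + 1
glue-count a a₁ a₂ c c₁ c₂ a-glue c-glue count₁ count₂ =
  +-cancelʳ-≡ 4 a (2 * c + 1) (begin
    a + 4                     ≡⟨ +-assoc a 2 2 ⟨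
    (a + 2) + 2               ≡⟨ cong (_+ 2) a-glue ⟩
    (a₁ + a₂) + 2             ≡⟨ +-assoc a₁ a₂ 2 ⟩
    a₁ + (a₂ + 2)             ≡⟨ cong₂ _+_ count₁ count₂ ⟩
    2 * c₁ + 1 + 2 * c₂       ≡⟨ lemma₁ c₁ c₂ ⟩
    2 * (c₁ + c₂) + 1         ≡⟨ cong (λ x → 2 * x + 1) c-glue ⟨
    2 * (c + 2) + 1           ≡⟨ lemma₂ c ⟩
    2 * c + 1 + 4             ∎)
  where
  open ≡-Reasoning
  lemma₁ : ∀ c₁ c₂ → 2 * c₁ + 1 + 2 * c₂ ≡ 2 * (c₁ + c₂) + 1
  lemma₁ = solve-∀
  lemma₂ : ∀ c → 2 * (c + 2) + 1 ≡ 2 * c + 1 + 4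
  lemma₂ = solve-∀

tight : ∀ {a b c d} → a ≤ b → c ≤ d → a + c ≡ b + d → a ≡ b × c ≡ d
tight {a} {b} {c} {d} a≤b c≤d sum≡ = a≡b , +-cancelˡ-≡ a c d (trans sum≡ (cong (_+ d) (sym a≡b)))
  where
  a≡b : a ≡ b
  a≡b = ≤-antisym a≤b (+-cancelʳ-≤ d b a (≤-trans (≤-reflexive (sym sum≡)) (+-monoʳ-≤ a c≤d)))

-- Splitting a rigid circuit count a_V = 2c_V + 1 into a sparse part Y (e_Y + 3 ≤ 2c_Y) and a
-- part Z with a_Z ≤ 2c_Z, overlapping in two vertices spanning e_X edges, forces e_X = 0 and
-- both bounds to be tight.
tight-split : ∀ aV eX eY aZ cV cY cZ →
  aV + eX ≡ eY + aZ → cV + 2 ≡ cY + cZ → aV ≡ 2 * cV + 1 →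
  eY + 3 ≤ 2 * cY → aZ ≤ 2 * cZ →
  eX ≡ 0 × eY + 3 ≡ 2 * cY × aZ ≡ 2 * cZ
tight-split aV eX eY aZ cV cY cZ a-split c-split countV boundY boundZ =
  eX≡0 , tight boundY boundZ (trans total (trans (cong (2 * cY + 2 * cZ +_) eX≡0) (+-identityʳ _)))
  where
  open ≡-Reasoning
  total : (eY + 3) + aZ ≡ 2 * cY + 2 * cZ + eX
  total = begin
    (eY + 3) + aZ             ≡⟨ lemma₁ eY aZ ⟩
    (eY + aZ) + 3             ≡⟨ cong (_+ 3) a-split ⟨
    (aV + eX) + 3             ≡⟨ cong (λ x → x + eX + 3) countV ⟩
    2 * cV + 1 + eX + 3       ≡⟨ lemma₂ cV eX ⟩
    2 * (cV + 2) + eX         ≡⟨ cong (λ x → 2 * x + eX) c-split ⟩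
    2 * (cY + cZ) + eX        ≡⟨ cong (_+ eX) (*-distribˡ-+ 2 cY cZ) ⟩
    2 * cY + 2 * cZ + eX      ∎
    where
    lemma₁ : ∀ eY aZ → (eY + 3) + aZ ≡ (eY + aZ) + 3
    lemma₁ = solve-∀
    lemma₂ : ∀ cV eX → 2 * cV + 1 + eX + 3 ≡ 2 * (cV + 2) + eX
    lemma₂ = solve-∀
  eX≡0 : eX ≡ 0
  eX≡0 = n≤0⇒n≡0 (+-cancelˡ-≤ (2 * cY + 2 * cZ) eX 0
    (≤-trans (≤-reflexive (sym total))
             (≤-trans (+-mono-≤ boundY boundZ) (≤-reflexive (sym (+-identityʳ _))))))

-- Removing from U a part T that is tight (a_T + t = 2c_T), glued along two vertices,
-- leaves a part W that inherits the bound of U with the margin changed accordingly.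
cut-tight : ∀ aU aW aT cU cW cT {s t} r →
  aU ≡ aW + aT → cU + 2 ≡ cW + cT → aU + s ≤ 2 * cU → aT + t ≡ 2 * cT → r + t ≤ s + 4 →
  aW + r ≤ 2 * cW
cut-tight aU aW aT cU cW cT {s} {t} r a-split c-split boundU tightT margin =
  +-cancelʳ-≤ (aT + t) (aW + r) (2 * cW) (begin
    aW + r + (aT + t)         ≡⟨ lemma₁ aW r aT t ⟩
    (aW + aT) + (r + t)       ≤⟨ +-monoʳ-≤ (aW + aT) margin ⟩
    (aW + aT) + (s + 4)       ≡⟨ cong (_+ (s + 4)) a-split ⟨
    aU + (s + 4)              ≡⟨ +-assoc aU s 4 ⟨
    aU + s + 4                ≤⟨ +-monoˡ-≤ 4 boundU ⟩
    2 * cU + 4                ≡⟨ *-distribˡ-+ 2 cU 2 ⟨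
    2 * (cU + 2)              ≡⟨ cong (2 *_) c-split ⟩
    2 * (cW + cT)             ≡⟨ *-distribˡ-+ 2 cW cT ⟩
    2 * cW + 2 * cT           ≡⟨ cong (2 * cW +_) tightT ⟨
    2 * cW + (aT + t)         ∎)
  where
  open ≤-Reasoning
  lemma₁ : ∀ aW r aT t → aW + r + (aT + t) ≡ (aW + aT) + (r + t)
  lemma₁ = solve-∀

drop-empty : ∀ a a₁ a₂ c c₁ s → a ≡ a₁ + a₂ → a₂ ≡ 0 → c₁ ≤ c → a₁ + s ≤ 2 * c₁ → a + s ≤ 2 * c
drop-empty a a₁ a₂ c c₁ s a-split a₂≡0 c₁≤c bound₁ = begin
  a + s          ≡⟨ cong (λ x → x + s) (trans a-split (trans (cong (a₁ +_) a₂≡0) (+-identityʳ a₁))) ⟩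
  a₁ + s         ≤⟨ bound₁ ⟩
  2 * c₁         ≤⟨ *-monoʳ-≤ 2 c₁≤c ⟩
  2 * c          ∎
  where open ≤-Reasoning

add-loops : ∀ e e₁ e₂ l l₁ {k} → e + k ≡ e₁ + e₂ → l ≡ l₁ → (e + l) + k ≡ (e₁ + l₁) + e₂
add-loops e e₁ e₂ l l₁ {k} edges refl = begin
  (e + l) + k     ≡⟨ lemma₁ e l k ⟩
  (e + k) + l     ≡⟨ cong (_+ l) edges ⟩
  (e₁ + e₂) + l   ≡⟨ lemma₂ e₁ e₂ l ⟩
  (e₁ + l) + e₂   ∎
  where
  open ≡-Reasoning
  lemma₁ : ∀ e l k → (e + l) + k ≡ (e + k) + l
  lemma₁ = solve-∀
  lemma₂ : ∀ e₁ e₂ l → (e₁ + e₂) + l ≡ (e₁ + l) + e₂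
  lemma₂ = solve-∀

merge-loops : ∀ eV eX eY eZ lV lX lZ → eV + eX ≡ eY + eZ → lV + lX ≡ lX + lZ →
  (eV + lV) + eX ≡ eY + (eZ + lZ)
merge-loops eV eX eY eZ lV lX lZ edges loops = begin
  (eV + lV) + eX         ≡⟨ lemma₁ eV lV eX ⟩
  (eV + eX) + lV         ≡⟨ cong (_+ lV) edges ⟩
  (eY + eZ) + lV         ≡⟨ cong ((eY + eZ) +_) lV≡lZ ⟩
  (eY + eZ) + lZ         ≡⟨ +-assoc eY eZ lZ ⟩
  eY + (eZ + lZ)         ∎
  where
  open ≡-Reasoning
  lV≡lZ : lV ≡ lZ
  lV≡lZ = +-cancelʳ-≡ lX lV lZ (trans loops (+-comm lX lZ))
  lemma₁ : ∀ eV lV eX → (eV + lV) + eX ≡ (eV + eX) + lV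
  lemma₁ = solve-∀

loops-left : ∀ eU eW eT lU lW → eU ≡ eW + eT → lU ≡ lW → eU + lU ≡ (eW + lW) + eT
loops-left eU eW eT lU lW refl refl = lemma eW eT lW
  where
  lemma : ∀ eW eT lW → (eW + eT) + lW ≡ (eW + lW) + eT
  lemma = solve-∀

loops-right : ∀ eU eW eT lU lT → eU ≡ eW + eT → lU ≡ lT → eU + lU ≡ eW + (eT + lT)
loops-right eU eW eT lU lT refl refl = +-assoc eW eT lT

one-more : ∀ e l → (e + 1) + l ≡ (e + l) + 1
one-more e l = trans (+-assoc e 1 l) (trans (cong (e +_) (+-comm 1 l)) (sym (+-assoc e l 1)))

reach-closed : ∀ {n} (G : LGraph n) {F : VSet n} (S : VSet n) →
  (∀ x y → S x ≡ true → E G x y ≡ true → F y ≡ false → S y ≡ true) →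
  ∀ {a b} → S a ≡ true → Reach G F a b → S b ≡ true
reach-closed G S closed Sa here               = Sa
reach-closed G S closed Sa (step e F∌y path) = reach-closed G S closed (closed _ _ Sa e F∌y) path

module _ {n} (G : LGraph n) where

  reach-mono : ∀ {F F′ : VSet n} → (∀ x → F x ≡ false → F′ x ≡ false) →
    ∀ {s t} → Reach G F s t → Reach G F′ s t
  reach-mono F⊇F′ here              = here
  reach-mono F⊇F′ (step e F∌y path) = step e (F⊇F′ _ F∌y) (reach-mono F⊇F′ path)

  reach-snoc : ∀ {F s t t′} → Reach G F s t → E G t t′ ≡ true → F t′ ≡ false → Reach G F s t′
  reach-snoc here              e F∌t′ = step e F∌t′ here
  reach-snoc (step e′ F∌y path) e F∌t′ = step e′ F∌y (reach-snoc path e F∌t′)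

  _⊕_ : VSet n → Fin n → VSet n
  (F ⊕ v) x = F x ∨ ⌊ x ≟ v ⌋

  ⊕-old : ∀ F v x → (F ⊕ v) x ≡ false → F x ≡ false
  ⊕-old F v x F⊕v∌x with F x
  ... | false = refl

  Leaves : VSet n → Fin n → Fin n → Set
  Leaves F v t = ∃[ y ] (E G v y ≡ true × (F ⊕ v) y ≡ false × Reach G (F ⊕ v) y t)

  last-visit : ∀ {F} v {s t} → Reach G F s t → Reach G (F ⊕ v) s t ⊎ (t ≡ v ⊎ Leaves F v t)
  last-visit v here = inj₁ here
  last-visit {F} v (step {v = y} e F∌y path) with last-visit v path
  ... | inj₂ later = inj₂ later
  ... | inj₁ avoiding with y ≟ v
  ...   | no y≢v =
    inj₁ (step e (trans (cong (F y ∨_) (≟-≢ y≢v)) (trans (Bool.∨-identityʳ (F y)) F∌y)) avoiding)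
  ...   | yes refl with avoiding
  ...     | here                   = inj₂ (inj₁ refl)
  ...     | step e′ F⊕v∌y′ path′   = inj₂ (inj₂ (_ , e′ , F⊕v∌y′ , path′))

  first-step : ∀ {F} v {t} → Reach G F v t → t ≡ v ⊎ Leaves F v t
  first-step v path with last-visit v path
  ... | inj₂ later                      = later
  ... | inj₁ here                       = inj₁ refl
  ... | inj₁ (step e F⊕v∌y path′)       = inj₂ (_ , e , F⊕v∌y , path′)

  allowed : VSet n → VSet n
  allowed F x = not (F x)

  allowed-⊕ : ∀ F {v} → F v ≡ false → card (allowed F) ≡ suc (card (allowed (F ⊕ v)))
  allowed-⊕ F {v} F∌v = trans (card-remove (allowed F) (cong not F∌v)) (cong suc (card-cong same))
    where
    same : allowed F － v ≗ allowed (F ⊕ v)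
    same x with F x
    ... | true  = refl
    ... | false = refl

  -- Reaching a vertex of T in G − F is decidable (depth-first search, by induction on the
  -- number of allowed vertices).
  reach? : ∀ (F T : VSet n) s → F s ≡ false → Dec (∃[ t ] (Reach G F s t × T t ≡ true))
  reach? F T s F∌s = search n F (card≤n (allowed F)) s F∌s
    where
    search : ∀ k F → card (allowed F) ≤ k → ∀ s → F s ≡ false → Dec (∃[ t ] (Reach G F s t × T t ≡ true))
    search zero F none s F∌s =
      ⊥-elim (<-irrefl refl (≤-trans (card-member {W = allowed F} (cong not F∌s)) none))
    search (suc k) F fuel s F∌s with T s in Ts
    ... | true  = yes (s , here , Ts)
    ... | false with any? via?
      where
      via : Fin n → Set
      via y = E G s y ≡ true × (F ⊕ s) y ≡ false × ∃[ t ] (Reach G (F ⊕ s) y t × T t ≡ true)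
      fuel′ : card (allowed (F ⊕ s)) ≤ k
      fuel′ = ≤-pred (subst (_≤ suc k) (allowed-⊕ F F∌s) fuel)
      via? : ∀ y → Dec (via y)
      via? y with E G s y in e | (F ⊕ s) y in F⊕s∋y
      ... | false | _     = no λ { (() , _) }
      ... | true  | true  = no λ { (_ , () , _) }
      ... | true  | false with search k (F ⊕ s) fuel′ y F⊕s∋y
      ...   | yes found = yes (refl , refl , found)
      ...   | no  none  = no λ { (_ , _ , found) → none found }
    ... | yes (y , e , F⊕s∌y , t , path , Tt) =
      yes (t , step e (⊕-old F s y F⊕s∌y) (reach-mono (⊕-old F s) path) , Tt)
    ... | no none = no unreachable
      where
      unreachable : ¬ (∃[ t ] (Reach G F s t × T t ≡ true))
      unreachable (t , path , Tt) with first-step s path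
      ... | inj₁ refl                        = true≢false (trans (sym Tt) Ts)
      ... | inj₂ (y , e , F⊕s∌y , path′)     = none (y , e , F⊕s∌y , t , path′ , Tt)

flexible-sparse : ∀ {n} {H : LGraph n} → FlexibleCircuit H →
  ∀ W → W ⊆ V H → 2 ≤ card W → iE H W + 2 ≤ 2 * card W
flexible-sparse {H = H} (_ , count , proper) W W⊆V 2≤W with ≗-dec W (V H)
... | yes W≗V = ≤-reflexive (trans (cong (_+ 2) (iE-cong H W≗V))
                            (trans count (cong (2 *_) (card-cong (sym ∘ W≗V)))))
... | no  W≉V = ≤-trans (+-monoʳ-≤ (iE H W) (n≤1+n 2)) (proper W (W⊆V , W≉V) 2≤W)

missing-end : ∀ {n} {X S : VSet n} {u v : Fin n} → (X u ∧ X v) ≡ false →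
  S u ≡ true → S v ≡ true → ¬ (X ∩ S ≗ S)
missing-end {X = X} {S} {u} {v} ¬uv Su Sv X∩S≗S =
  true≢false (trans (sym (cong₂ _∧_ (in-X u Su) (in-X v Sv))) ¬uv)
  where
  in-X : ∀ x → S x ≡ true → X x ≡ true
  in-X x Sx = proj₁ (∧-true (trans (X∩S≗S x) Sx))

-- The edges of a 2-sum: each edge of G is an edge of exactly one of G₁, G₂ and the
-- virtual edge uv belongs to both.
two-sum-edge : ∀ e₁ e₂ →
  b2n ((e₁ ∨ e₂) ∧ not (e₁ ∧ e₂)) + (b2n (e₁ ∧ e₂) + b2n (e₁ ∧ e₂)) ≡ b2n e₁ + b2n e₂
two-sum-edge true  true  = refl
two-sum-edge true  false = refl
two-sum-edge false true  = refl
two-sum-edge false false = refl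

module TwoSum {n} {G G₁ G₂ : LGraph n} {u v : Fin n}
  (V-∪ : ∀ x → V G x ≡ (V G₁ x ∨ V G₂ x))
  (V-∩ : ∀ x → (V G₁ x ∧ V G₂ x) ≡ pairSet u v x)
  (E-∩ : ∀ x y → (E G₁ x y ∧ E G₂ x y) ≡ joins u v x y)
  (E-∪ : ∀ x y → E G x y ≡ ((E G₁ x y ∨ E G₂ x y) ∧ not (joins u v x y)))
  (L-+ : ∀ x → L G x ≡ L G₁ x + L G₂ x) where

  V₁ V₂ : VSet n
  V₁ = V G₁
  V₂ = V G₂

  u≢v : u ≢ v
  u≢v refl = true≢false (trans (sym joins-uu) (trans (sym (E-∩ u u)) (cong (_∧ E G₂ u u) (E-irr G₁ u))))
    where
    joins-uu : joins u u u u ≡ true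
    joins-uu = cong (λ b → (b ∧ b) ∨ (b ∧ b)) (≟-refl u)

  u∈V₁∩V₂ : V₁ u ≡ true × V₂ u ≡ true
  u∈V₁∩V₂ = ∧-true (trans (V-∩ u) (pairSet-fst u v))

  v∈V₁∩V₂ : V₁ v ≡ true × V₂ v ≡ true
  v∈V₁∩V₂ = ∧-true (trans (V-∩ v) (pairSet-snd u v))

  V₁⊆V : V₁ ⊆ V G
  V₁⊆V x V₁x = trans (V-∪ x) (cong (_∨ V₂ x) V₁x)

  V₂⊆V : V₂ ⊆ V G
  V₂⊆V x V₂x = trans (V-∪ x) (trans (cong (V₁ x ∨_) V₂x) (Bool.∨-zeroʳ _))

  edge-split : ∀ X → let b = b2n (X u ∧ X v) in
    iE G X + (b + b) ≡ iE G₁ (X ∩ V₁) + iE G₂ (X ∩ V₂)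
  edge-split X = begin
    iE G X + (b2n (X u ∧ X v) + b2n (X u ∧ X v))
      ≡⟨ cong₂ (λ p q → p + (q + q)) (iE≡pairs G X) (sym (pairs-joins u≢v X)) ⟩
    pairs (below (E G)) X + (pairs Juv X + pairs Juv X)
      ≡⟨ cong (pairs (below (E G)) X +_) (pairs-+ Juv Juv X) ⟨
    pairs (below (E G)) X + pairs (λ x y → Juv x y + Juv x y) X
      ≡⟨ pairs-+ (below (E G)) _ X ⟨
    pairs (λ x y → below (E G) x y + (Juv x y + Juv x y)) X
      ≡⟨ pairs-congʷ X (λ x y _ _ → pointwise x y) ⟩
    pairs (λ x y → below (E G₁) x y + below (E G₂) x y) X
      ≡⟨ pairs-+ (below (E G₁)) (below (E G₂)) X ⟩
    pairs (below (E G₁)) X + pairs (below (E G₂)) X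
      ≡⟨ cong₂ _+_ (iE≡pairs G₁ X) (iE≡pairs G₂ X) ⟨
    iE G₁ X + iE G₂ X
      ≡⟨ cong₂ _+_ (iE-restrict G₁ X) (iE-restrict G₂ X) ⟩
    iE G₁ (X ∩ V₁) + iE G₂ (X ∩ V₂) ∎
    where
    open ≡-Reasoning
    Juv : Fin n → Fin n → ℕ
    Juv = below (joins u v)
    pointwise : ∀ x y → below (E G) x y + (Juv x y + Juv x y) ≡ below (E G₁) x y + below (E G₂) x y
    pointwise x y rewrite E-∪ x y | sym (E-∩ x y) with ⌊ toℕ x <? toℕ y ⌋
    ... | false = refl
    ... | true  = two-sum-edge (E G₁ x y) (E G₂ x y)

  card-split : ∀ X → X ⊆ V G → card X + (b2n (X u) + b2n (X v)) ≡ card (X ∩ V₁) + card (X ∩ V₂)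
  card-split X X⊆V = begin
    card X + (b2n (X u) + b2n (X v))
      ≡⟨ cong₂ _+_ (card-cong cover) (sym (trans (card-cong shared) (card-∩pairSet X u≢v))) ⟩
    card ((X ∩ V₁) ∪ (X ∩ V₂)) + card ((X ∩ V₁) ∩ (X ∩ V₂))
      ≡⟨ card-mod (X ∩ V₁) (X ∩ V₂) ⟩
    card (X ∩ V₁) + card (X ∩ V₂) ∎
    where
    open ≡-Reasoning
    cover : X ≗ (X ∩ V₁) ∪ (X ∩ V₂)
    cover x with X x in Xx
    ... | false = refl
    ... | true  = trans (sym (X⊆V x Xx)) (V-∪ x)
    shared : (X ∩ V₁) ∩ (X ∩ V₂) ≗ X ∩ pairSet u v
    shared x with X x
    ... | false = refl
    ... | true  = V-∩ x

  loop-split : (∀ x → L G₂ x ≡ 0) → ∀ X → iL G X ≡ iL G₁ (X ∩ V₁)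
  loop-split loopless X = begin
    iL G X               ≡⟨ iL≡weight G X ⟩
    weight (L G) X       ≡⟨ weight-congʷ only-G₁ X ⟩
    weight (L G₁) X      ≡⟨ iL≡weight G₁ X ⟨
    iL G₁ X              ≡⟨ iL-restrict G₁ X ⟩
    iL G₁ (X ∩ V₁)       ∎
    where
    open ≡-Reasoning
    only-G₁ : ∀ x → L G x ≡ L G₁ x
    only-G₁ x = trans (L-+ x) (trans (cong (L G₁ x +_) (loopless x)) (+-identityʳ _))

  both-edges : ∀ X → X u ≡ true → X v ≡ true → iE G X + 2 ≡ iE G₁ (X ∩ V₁) + iE G₂ (X ∩ V₂)
  both-edges X Xu Xv = trans (cong (λ b → iE G X + (b2n b + b2n b)) (sym (cong₂ _∧_ Xu Xv))) (edge-split X)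

  both-cards : ∀ X → X ⊆ V G → X u ≡ true → X v ≡ true → card X + 2 ≡ card (X ∩ V₁) + card (X ∩ V₂)
  both-cards X X⊆V Xu Xv =
    trans (cong (λ b → card X + b) (sym (cong₂ (λ p q → b2n p + b2n q) Xu Xv))) (card-split X X⊆V)

  apart-edges : ∀ X → (X u ∧ X v) ≡ false → iE G X + 0 ≡ iE G₁ (X ∩ V₁) + iE G₂ (X ∩ V₂)
  apart-edges X ¬uv = trans (cong (λ b → iE G X + (b2n b + b2n b)) (sym ¬uv)) (edge-split X)

  apart-cards : ∀ X → X ⊆ V G → (X u ∧ X v) ≡ false → card (X ∩ V₁) + card (X ∩ V₂) ≤ card X + 1
  apart-cards X X⊆V ¬uv =
    subst (_≤ card X + 1) (card-split X X⊆V) (+-monoʳ-≤ (card X) (at-most-one (X u) (X v) ¬uv))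
    where
    at-most-one : ∀ a b → (a ∧ b) ≡ false → b2n a + b2n b ≤ 1
    at-most-one true  false _ = ≤-refl
    at-most-one false true  _ = ≤-refl
    at-most-one false false _ = z≤n

  both-two : ∀ X (S : VSet n) → X u ≡ true → X v ≡ true → S u ≡ true → S v ≡ true → 2 ≤ card (X ∩ S)
  both-two X S Xu Xv Su Sv = card-two {W = X ∩ S} u≢v (cong₂ _∧_ Xu Su) (cong₂ _∧_ Xv Sv)

  module _ (rigid₁ : RigidCircuit G₁) (flexible₂ : FlexibleCircuit G₂) where

    count₁ : iE G₁ V₁ + iL G₁ V₁ ≡ 2 * card V₁ + 1
    count₁ = proj₁ rigid₁
    sparse₁ : ∀ X → X ⊆ V₁ → 2 ≤ card X → iE G₁ X + 3 ≤ 2 * card X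
    sparse₁ = proj₁ (proj₂ rigid₁)
    proper₁ : ∀ X → X ⊊ V₁ → iEL G₁ X ≤ 2 * card X
    proper₁ = proj₂ (proj₂ rigid₁)
    loopless₂ : ∀ x → L G₂ x ≡ 0
    loopless₂ = proj₁ flexible₂
    count₂ : iE G₂ V₂ + 2 ≡ 2 * card V₂
    count₂ = proj₁ (proj₂ flexible₂)
    proper₂ : ∀ X → X ⊊ V₂ → 2 ≤ card X → iE G₂ X + 3 ≤ 2 * card X
    proper₂ = proj₂ (proj₂ flexible₂)

    u₁ : V₁ u ≡ true
    u₁ = proj₁ u∈V₁∩V₂
    u₂ : V₂ u ≡ true
    u₂ = proj₂ u∈V₁∩V₂
    v₁ : V₁ v ≡ true
    v₁ = proj₁ v∈V₁∩V₂
    v₂ : V₂ v ≡ true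
    v₂ = proj₂ v∈V₁∩V₂

    count : iE G (V G) + iL G (V G) ≡ 2 * card (V G) + 1
    count = glue-count (iE G V′ + iL G V′) (iE G₁ V′₁ + iL G₁ V′₁) (iE G₂ V′₂) (card V′) (card V′₁) (card V′₂)
      (add-loops (iE G V′) (iE G₁ V′₁) (iE G₂ V′₂) (iL G V′) (iL G₁ V′₁)
        (both-edges V′ (proj₁ uv∈V) (proj₂ uv∈V)) (loop-split loopless₂ V′))
      (both-cards V′ (λ _ Vx → Vx) (proj₁ uv∈V) (proj₂ uv∈V))
      (trans (cong₂ _+_ (iE-cong G₁ on-V₁) (iL-cong G₁ on-V₁))
             (trans count₁ (cong (λ c → 2 * c + 1) (sym (card-cong on-V₁)))))
      (trans (cong (_+ 2) (iE-cong G₂ on-V₂)) (trans count₂ (cong (2 *_) (sym (card-cong on-V₂)))))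
      where
      V′ V′₁ V′₂ : VSet n
      V′ = V G
      V′₁ = V G ∩ V₁
      V′₂ = V G ∩ V₂
      on-V₁ : V′₁ ≗ V₁
      on-V₁ = ∩-absorb V₁⊆V
      on-V₂ : V′₂ ≗ V₂
      on-V₂ = ∩-absorb V₂⊆V
      uv∈V : V G u ≡ true × V G v ≡ true
      uv∈V = V₁⊆V u u₁ , V₁⊆V v v₁

    module _ (X : VSet n) (X⊆V : X ⊆ V G) where

      X₁ X₂ : VSet n
      X₁ = X ∩ V₁
      X₂ = X ∩ V₂

      sparse-both : X u ≡ true → X v ≡ true → iE G X + 3 ≤ 2 * card X
      sparse-both Xu Xv =
        glue-bounds (iE G X) (iE G₁ X₁) (iE G₂ X₂) (card X) (card X₁) (card X₂) 0 0 3
          (both-edges X Xu Xv) (≤-reflexive (sym (both-cards X X⊆V Xu Xv)))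
          (sparse₁ X₁ (∩⊆ X V₁) (both-two X V₁ Xu Xv u₁ v₁))
          (flexible-sparse {H = G₂} flexible₂ X₂ (∩⊆ X V₂) (both-two X V₂ Xu Xv u₂ v₂))
          (≤ᵇ⇒≤ _ _ _)

      sparse-apart : 2 ≤ card X → (X u ∧ X v) ≡ false → iE G X + 3 ≤ 2 * card X
      sparse-apart 2≤X ¬uv with 2 ≤? card X₁ | 2 ≤? card X₂
      ... | yes 2≤X₁ | yes 2≤X₂ =
        glue-bounds (iE G X) (iE G₁ X₁) (iE G₂ X₂) (card X) (card X₁) (card X₂) 0 0 3
          (apart-edges X ¬uv) (apart-cards X X⊆V ¬uv)
          (sparse₁ X₁ (∩⊆ X V₁) 2≤X₁)
          (proper₂ X₂ (∩⊆ X V₂ , missing-end ¬uv u₂ v₂) 2≤X₂)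
          (≤ᵇ⇒≤ _ _ _)
      ... | yes 2≤X₁ | no 2≰X₂ =
        drop-empty (iE G X) (iE G₁ X₁) (iE G₂ X₂) (card X) (card X₁) 3
          (trans (sym (+-identityʳ _)) (apart-edges X ¬uv)) (iE-small G₂ (≱2⇒≤1 2≰X₂))
          (card-mono (∩⊆ˡ X V₁)) (sparse₁ X₁ (∩⊆ X V₁) 2≤X₁)
      ... | no 2≰X₁ | yes 2≤X₂ =
        drop-empty (iE G X) (iE G₂ X₂) (iE G₁ X₁) (card X) (card X₂) 3
          (trans (sym (+-identityʳ _)) (trans (apart-edges X ¬uv) (+-comm (iE G₁ X₁) (iE G₂ X₂))))
          (iE-small G₁ (≱2⇒≤1 2≰X₁))
          (card-mono (∩⊆ˡ X V₂)) (proper₂ X₂ (∩⊆ X V₂ , missing-end ¬uv u₂ v₂) 2≤X₂)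
      ... | no 2≰X₁ | no 2≰X₂ =
        subst (λ e → e + 3 ≤ 2 * card X) (sym no-edges) (≤-trans (n≤1+n 3) (*-monoʳ-≤ 2 2≤X))
        where
        no-edges : iE G X ≡ 0
        no-edges = +-cancelʳ-≡ 0 (iE G X) 0 (trans (apart-edges X ¬uv)
                     (cong₂ _+_ (iE-small G₁ (≱2⇒≤1 2≰X₁)) (iE-small G₂ (≱2⇒≤1 2≰X₂))))

      -- Edges and loops of X together; all loops lie on the side of G₁.
      aX a₁ e₂ : ℕ
      aX = iE G X + iL G X
      a₁ = iE G₁ X₁ + iL G₁ X₁
      e₂ = iE G₂ X₂

      both-mass : X u ≡ true → X v ≡ true → aX + 2 ≡ a₁ + e₂
      both-mass Xu Xv = add-loops (iE G X) (iE G₁ X₁) e₂ (iL G X) (iL G₁ X₁)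
        (both-edges X Xu Xv) (loop-split loopless₂ X)

      apart-mass : (X u ∧ X v) ≡ false → aX + 0 ≡ a₁ + e₂
      apart-mass ¬uv = add-loops (iE G X) (iE G₁ X₁) e₂ (iL G X) (iL G₁ X₁)
        (apart-edges X ¬uv) (loop-split loopless₂ X)

      -- A proper subset X containing u and v: at least one side is a proper subset.
      proper-both : ¬ (X ≗ V G) → X u ≡ true → X v ≡ true → iEL G X ≤ 2 * card X
      proper-both X≉V Xu Xv with ≗-dec X₁ V₁ | ≗-dec X₂ V₂
      ... | yes X₁≗V₁ | yes X₂≗V₂ = ⊥-elim (X≉V everything)
        where
        everything : X ≗ V G
        everything x with X x in Xx
        ... | true  = sym (X⊆V x Xx)
        ... | false = sym (trans (V-∪ x) (cong₂ _∨_ (outside X₁≗V₁) (outside X₂≗V₂)))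
          where
          outside : ∀ {S} → X ∩ S ≗ S → S x ≡ false
          outside {S} X∩S≗S = sym (trans (sym (cong (_∧ S x) Xx)) (X∩S≗S x))
      ... | no X₁≉V₁ | _ = +0-elim
        (glue-bounds aX a₁ e₂ (card X) (card X₁) (card X₂) 0 0 0
          (both-mass Xu Xv) (≤-reflexive (sym (both-cards X X⊆V Xu Xv)))
          (+0-intro (proper₁ X₁ (∩⊆ X V₁ , X₁≉V₁)))
          (flexible-sparse {H = G₂} flexible₂ X₂ (∩⊆ X V₂) (both-two X V₂ Xu Xv u₂ v₂))
          (≤ᵇ⇒≤ _ _ _))
      ... | yes X₁≗V₁ | no X₂≉V₂ = +0-elim
        (glue-bounds aX a₁ e₂ (card X) (card X₁) (card X₂) 1 0 0
          (both-mass Xu Xv) (≤-reflexive (sym (both-cards X X⊆V Xu Xv)))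
          (≤-reflexive (trans (+-identityʳ a₁) (trans count-X₁ (+-comm _ 1))))
          (proper₂ X₂ (∩⊆ X V₂ , X₂≉V₂) (both-two X V₂ Xu Xv u₂ v₂))
          (≤ᵇ⇒≤ _ _ _))
        where
        count-X₁ : a₁ ≡ 2 * card X₁ + 1
        count-X₁ = trans (cong₂ _+_ (iE-cong G₁ X₁≗V₁) (iL-cong G₁ X₁≗V₁))
                         (trans count₁ (cong (λ c → 2 * c + 1) (sym (card-cong X₁≗V₁))))

      -- A set X missing u or v: both sides are proper subsets.
      proper-apart : (X u ∧ X v) ≡ false → iEL G X ≤ 2 * card X
      proper-apart ¬uv with 2 ≤? card X₂
      ... | yes 2≤X₂ = +0-elim
        (glue-bounds aX a₁ e₂ (card X) (card X₁) (card X₂) 0 0 0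
          (apart-mass ¬uv) (apart-cards X X⊆V ¬uv)
          (+0-intro (proper₁ X₁ (∩⊆ X V₁ , missing-end ¬uv u₁ v₁)))
          (proper₂ X₂ (∩⊆ X V₂ , missing-end ¬uv u₂ v₂) 2≤X₂)
          (≤ᵇ⇒≤ _ _ _))
      ... | no 2≰X₂ = +0-elim
        (drop-empty aX a₁ e₂ (card X) (card X₁) 0
          (trans (sym (+-identityʳ aX)) (apart-mass ¬uv)) (iE-small G₂ (≱2⇒≤1 2≰X₂))
          (card-mono (∩⊆ˡ X V₁)) (+0-intro (proper₁ X₁ (∩⊆ X V₁ , missing-end ¬uv u₁ v₁))))

    sparse : ∀ X → X ⊆ V G → 2 ≤ card X → iE G X + 3 ≤ 2 * card X
    sparse X X⊆V 2≤X with X u ∧ X v in uv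
    ... | true  = sparse-both X X⊆V (proj₁ (∧-true uv)) (proj₂ (∧-true uv))
    ... | false = sparse-apart X X⊆V 2≤X uv

    proper : ∀ X → X ⊊ V G → iEL G X ≤ 2 * card X
    proper X (X⊆V , X≉V) with X u ∧ X v in uv
    ... | true  = proper-both X X⊆V X≉V (proj₁ (∧-true uv)) (proj₂ (∧-true uv))
    ... | false = proper-apart X X⊆V uv

    -- V₂ has a vertex other than u and v: otherwise G₂ would have at most the edge uv,
    -- contradicting |E₂| + 2 = 2|V₂| ≥ 4.
    inner-vertex : ∃[ w ] (V₂ w ≡ true × w ≢ u × w ≢ v)
    inner-vertex with any? (λ w → (V₂ w Bool.≟ true) ×-dec (¬? (w ≟ u) ×-dec ¬? (w ≟ v)))
    ... | yes found = found
    ... | no none   = ⊥-elim (<-irrefl count₂ (begin-strict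
          iE G₂ V₂ + 2                       ≤⟨ +-monoˡ-≤ 2 at-most-uv ⟩
          b2n (V₂ u ∧ V₂ v) + 2              ≡⟨ cong (λ b → b2n b + 2) (cong₂ _∧_ u₂ v₂) ⟩
          3                                  <⟨ ≤-refl ⟩
          4                                  ≤⟨ *-monoʳ-≤ 2 (card-two {W = V₂} u≢v u₂ v₂) ⟩
          2 * card V₂                        ∎))
      where
      open ≤-Reasoning
      only-uv : ∀ x → V₂ x ≡ true → pairSet u v x ≡ true
      only-uv x V₂x with x ≟ u | x ≟ v
      ... | yes _   | _       = refl
      ... | no _    | yes _   = refl
      ... | no x≢u  | no x≢v  = ⊥-elim (none (x , V₂x , x≢u , x≢v))
      edge-is-uv : ∀ x y → V₂ x ≡ true → V₂ y ≡ true → below (E G₂) x y ≤ below (joins u v) x y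
      edge-is-uv x y V₂x V₂y with E G₂ x y in e
      ... | false = subst (_≤ below (joins u v) x y) (sym (below-absent (λ _ _ → false) {x} {y} refl)) z≤n
      ... | true  = ≤-reflexive (cong (λ b → b2n (⌊ toℕ x <? toℕ y ⌋ ∧ b))
                      (sym (joins-ends u≢v (only-uv x V₂x) (only-uv y V₂y) x≢y)))
        where
        x≢y : x ≢ y
        x≢y refl = true≢false (trans (sym e) (E-irr G₂ x))
      at-most-uv : iE G₂ V₂ ≤ b2n (V₂ u ∧ V₂ v)
      at-most-uv = subst₂ _≤_ (sym (iE≡pairs G₂ V₂)) (pairs-joins u≢v V₂) (pairs-mono V₂ edge-is-uv)

    -- In G − {u, v} the vertices of V₂ other than u, v only reach such vertices,
    -- and these carry no loops.
    inner : VSet n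
    inner x = V₂ x ∧ not (pairSet u v x)

    not-in-V₁ : ∀ {x} → inner x ≡ true → V₁ x ≡ false
    not-in-V₁ {x} inner-x =
      false-if-not-true λ V₁x → true≢false (trans (sym (trans (sym (V-∩ x)) (cong₂ _∧_ V₁x V₂x))) not-uv)
      where
      V₂x : V₂ x ≡ true
      V₂x = proj₁ (∧-true inner-x)
      not-uv : pairSet u v x ≡ false
      not-uv = not-true (proj₂ (∧-true inner-x))

    inner-closed : ∀ x y → inner x ≡ true → E G x y ≡ true → pairSet u v y ≡ false → inner y ≡ true
    inner-closed x y inner-x e uv∌y with ∨-true (proj₁ (∧-true (trans (sym (E-∪ x y)) e)))
    ... | inj₁ e₁ = true≢false (trans (sym (E-V G₁ x y e₁)) (not-in-V₁ inner-x))
    ... | inj₂ e₂ = cong₂ (λ p q → p ∧ not q) (E-V G₂ y x (trans (E-sym G₂ y x) e₂)) uv∌y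

    inner-loopless : ∀ {x} → inner x ≡ true → L G x ≡ 0
    inner-loopless {x} inner-x =
      trans (L-+ x) (cong₂ _+_ (L-V G₁ x (not-in-V₁ inner-x)) (loopless₂ x))

    not-balanced : ¬ Balanced G
    not-balanced balanced =
      let (w , V₂w , w≢u , w≢v) = inner-vertex
          (w′ , path , has-loop) = balanced (pairSet u v) (pairSet-⊆ (V₁⊆V u u₁) (V₁⊆V v v₁))
                                     (card-pairSet u≢v) w (V₂⊆V w V₂w) (pairSet-out w≢u w≢v)
          inner-w = cong₂ (λ p q → p ∧ not q) V₂w (pairSet-out w≢u w≢v)
      in has-loop (inner-loopless (reach-closed G inner inner-closed inner-w path))

    rigid-not-balanced : RigidCircuit G × ¬ Balanced G
    rigid-not-balanced = (count , sparse , proper) , not-balanced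

hasLoop : ∀ {n} → LGraph n → VSet n
hasLoop G x = not ⌊ L G x ℕ.≟ 0 ⌋

hasLoop-sound : ∀ {n} (G : LGraph n) {x} → hasLoop G x ≡ true → ¬ L G x ≡ 0
hasLoop-sound G {x} loop L≡0 with L G x ℕ.≟ 0
... | yes _   = true≢false (sym loop)
... | no L≢0  = L≢0 L≡0

hasLoop-complete : ∀ {n} (G : LGraph n) {x} → hasLoop G x ≡ false → L G x ≡ 0
hasLoop-complete G {x} no-loop with L G x ℕ.≟ 0
... | yes L≡0 = L≡0

LooplessComponent : ∀ {n} → LGraph n → Fin n → Fin n → Fin n → Set
LooplessComponent G a b w =
  a ≢ b × V G a ≡ true × V G b ≡ true × V G w ≡ true × pairSet a b w ≡ false ×
  ¬ (∃[ t ] (Reach G (pairSet a b) w t × hasLoop G t ≡ true))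

loopless-component? : ∀ {n} (G : LGraph n) a b w → Dec (LooplessComponent G a b w)
loopless-component? G a b w with pairSet a b w in ab∋w
... | true  = no λ (_ , _ , _ , _ , ab∌w , _) → true≢false ab∌w
... | false = map′ (λ (a≢b , Va , Vb , Vw , none) → a≢b , Va , Vb , Vw , refl , none)
                   (λ (a≢b , Va , Vb , Vw , _ , none) → a≢b , Va , Vb , Vw , none)
                   (¬? (a ≟ b) ×-dec (V G a Bool.≟ true) ×-dec (V G b Bool.≟ true) ×-dec
                    (V G w Bool.≟ true) ×-dec ¬? (reach? G (pairSet a b) (hasLoop G) w ab∋w))

unbalanced-witness : ∀ {n} (G : LGraph n) → ¬ Balanced G → ∃[ a ] ∃[ b ] ∃[ w ] LooplessComponent G a b w
unbalanced-witness G unbalanced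
  with any? (λ a → any? (λ b → any? (λ w → loopless-component? G a b w)))
... | yes found = found
... | no none   = ⊥-elim (unbalanced balanced)
  where
  balanced : Balanced G
  balanced X X⊆V |X|≡2 w Vw X∌w with card≡2 X |X|≡2
  ... | a , b , a≢b , X≗ab with reach? G (pairSet a b) (hasLoop G) w (trans (sym (X≗ab w)) X∌w)
  ...   | yes (t , path , loop) =
    t , reach-mono G (λ x ab∌x → trans (X≗ab x) ab∌x) path , hasLoop-sound G loop
  ...   | no  no-loop = ⊥-elim (none (a , b , w , a≢b , X⊆V a (trans (X≗ab a) (pairSet-fst a b)) ,
                                     X⊆V b (trans (X≗ab b) (pairSet-snd a b)) , Vw ,
                                     trans (sym (X≗ab w)) X∌w , no-loop))

non-edge-joins : ∀ {n} (G : LGraph n) {a b : Fin n} → E G a b ≡ false →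
  ∀ x y → (E G x y ∧ joins a b x y) ≡ false
non-edge-joins G {a} {b} ¬ab x y with joins a b x y in xy=ab
... | false = Bool.∧-zeroʳ _
... | true with joins-cases a b x y xy=ab
...   | inj₁ (refl , refl) = cong (_∧ true) ¬ab
...   | inj₂ (refl , refl) = cong (_∧ true) (trans (E-sym G b a) ¬ab)

-- G[S] + ab: the subgraph of G induced on S with the edge ab added, with loops ℓ.
plusEdge : ∀ {n} → LGraph n → VSet n → Fin n → Fin n → Fin n → Fin n → Bool
plusEdge G S a b x y = (E G x y ∧ (S x ∧ S y)) ∨ joins a b x y

module _ {n} (G : LGraph n) (S : VSet n) {a b : Fin n} (a≢b : a ≢ b) (Sa : S a ≡ true) (Sb : S b ≡ true)
         (ℓ : Fin n → ℕ) (ℓ-S : ∀ x → S x ≡ false → ℓ x ≡ 0) where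

  withEdge : LGraph n
  withEdge = record
    { V = S ; E = plusEdge G S a b ; L = ℓ
    ; E-sym = λ x y → cong₂ _∨_ (cong₂ _∧_ (E-sym G x y) (Bool.∧-comm (S x) (S y))) (joins-sym a b x y)
    ; E-irr = λ x → cong₂ _∨_ (cong (_∧ (S x ∧ S x)) (E-irr G x)) (joins-diag a≢b x)
    ; E-V = ends-in-S ; L-V = ℓ-S }
    where
    ends-in-S : ∀ x y → plusEdge G S a b x y ≡ true → S x ≡ true
    ends-in-S x y e with ∨-true {E G x y ∧ (S x ∧ S y)} e
    ... | inj₁ inside = proj₁ (∧-true {S x} (proj₂ (∧-true {E G x y} inside)))
    ... | inj₂ xy=ab with joins-cases a b x y xy=ab
    ...   | inj₁ (refl , _) = Sa
    ...   | inj₂ (refl , _) = Sb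

  withEdge-iE : E G a b ≡ false → ∀ W → W ⊆ S → iE withEdge W ≡ iE G W + b2n (W a ∧ W b)
  withEdge-iE ¬ab W W⊆S = begin
    iE withEdge W                                        ≡⟨ iE≡pairs withEdge W ⟩
    pairs (below (plusEdge G S a b)) W                   ≡⟨ pairs-congʷ W pointwise ⟩
    pairs (λ x y → below (E G) x y + below (joins a b) x y) W ≡⟨ pairs-+ (below (E G)) _ W ⟩
    pairs (below (E G)) W + pairs (below (joins a b)) W
      ≡⟨ cong₂ _+_ (sym (iE≡pairs G W)) (pairs-joins a≢b W) ⟩
    iE G W + b2n (W a ∧ W b)                             ∎
    where
    open ≡-Reasoning
    disjoint : ∀ e j → (e ∧ j) ≡ false → b2n ((e ∧ true) ∨ j) ≡ b2n e + b2n j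
    disjoint true  false _ = refl
    disjoint false true  _ = refl
    disjoint false false _ = refl
    pointwise : ∀ x y → W x ≡ true → W y ≡ true →
      below (plusEdge G S a b) x y ≡ below (E G) x y + below (joins a b) x y
    pointwise x y Wx Wy rewrite W⊆S x Wx | W⊆S y Wy with ⌊ toℕ x <? toℕ y ⌋
    ... | false = refl
    ... | true  = disjoint (E G x y) (joins a b x y) (non-edge-joins G ¬ab x y)

TwoSumOfCircuits : ∀ {n} → LGraph n → Set
TwoSumOfCircuits G = ∃[ G₁ ] ∃[ G₂ ] (IsTwoSum G G₁ G₂ × RigidCircuit G₁ × FlexibleCircuit G₂)

-- A rigid circuit G with a loopless component C of G − {a, b} (containing w) splits along ab
-- into G[V ∖ C] + ab and G[C ∪ {a, b}] + ab.
module Separation {n} (G : LGraph n) (rigid : RigidCircuit G) {a b w : Fin n}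
  (piece : LooplessComponent G a b w) where

  a≢b : a ≢ b
  a≢b = proj₁ piece
  Va : V G a ≡ true
  Va = proj₁ (proj₂ piece)
  Vb : V G b ≡ true
  Vb = proj₁ (proj₂ (proj₂ piece))
  Vw : V G w ≡ true
  Vw = proj₁ (proj₂ (proj₂ (proj₂ piece)))
  ab∌w : pairSet a b w ≡ false
  ab∌w = proj₁ (proj₂ (proj₂ (proj₂ (proj₂ piece))))
  no-loop : ¬ (∃[ t ] (Reach G (pairSet a b) w t × hasLoop G t ≡ true))
  no-loop = proj₂ (proj₂ (proj₂ (proj₂ (proj₂ piece))))

  count : iE G (V G) + iL G (V G) ≡ 2 * card (V G) + 1
  count = proj₁ rigid
  sparse : ∀ W → W ⊆ V G → 2 ≤ card W → iE G W + 3 ≤ 2 * card W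
  sparse = proj₁ (proj₂ rigid)
  proper : ∀ W → W ⊊ V G → iEL G W ≤ 2 * card W
  proper = proj₂ (proj₂ rigid)

  X : VSet n
  X = pairSet a b

  C : VSet n
  C x = ⌊ reach? G X (λ t → ⌊ t ≟ x ⌋) w ab∌w ⌋

  C-sound : ∀ {x} → C x ≡ true → Reach G X w x
  C-sound {x} Cx with toWitness (Equivalence.from Bool.T-≡ Cx)
  ... | t , path , t≟x with t ≟ x
  ...   | yes refl = path
  ...   | no _     = true≢false (sym t≟x)

  C-complete : ∀ {x} → Reach G X w x → C x ≡ true
  C-complete {x} path = Equivalence.to Bool.T-≡ (fromWitness (x , path , ≟-refl x))

  Cw : C w ≡ true
  Cw = C-complete here

  C⊆V : C ⊆ V G
  C⊆V x Cx = reach-closed G (V G) (λ y z _ e _ → E-V G z y (trans (E-sym G z y) e)) Vw (C-sound Cx)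

  C-avoids-X : ∀ {x} → C x ≡ true → X x ≡ false
  C-avoids-X Cx = not-true (reach-closed G (λ y → not (X y)) (λ _ _ _ _ X∌z → cong not X∌z)
                              (cong not ab∌w) (C-sound Cx))

  C-loopless : ∀ {x} → C x ≡ true → L G x ≡ 0
  C-loopless {x} Cx with hasLoop G x in loop
  ... | true  = ⊥-elim (no-loop (x , C-sound Cx , loop))
  ... | false = hasLoop-complete G loop

  C-closed : ∀ {x y} → C x ≡ true → E G x y ≡ true → X y ≡ false → C y ≡ true
  C-closed Cx e X∌y = C-complete (reach-snoc G (C-sound Cx) e X∌y)

  Y Z : VSet n
  Y = C ∪ X
  Z x = V G x ∧ not (C x)

  X⊆V : X ⊆ V G
  X⊆V = pairSet-⊆ Va Vb

  X⊆Y : X ⊆ Y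
  X⊆Y x Xx = trans (cong (C x ∨_) Xx) (Bool.∨-zeroʳ (C x))

  X⊆Z : X ⊆ Z
  X⊆Z x Xx with C x in Cx
  ... | true  = true≢false (trans (sym Xx) (C-avoids-X Cx))
  ... | false = cong (_∧ true) (X⊆V x Xx)

  Y⊆V : Y ⊆ V G
  Y⊆V = ∪-⊆ C⊆V X⊆V

  Z⊆V : Z ⊆ V G
  Z⊆V x Zx = proj₁ (∧-true Zx)

  Y∪Z≗V : Y ∪ Z ≗ V G
  Y∪Z≗V x with C x in Cx | X x in Xx
  ... | true  | _     = sym (C⊆V x Cx)
  ... | false | true  = sym (X⊆V x Xx)
  ... | false | false = Bool.∧-identityʳ (V G x)

  Y∩Z≗X : Y ∩ Z ≗ X
  Y∩Z≗X x with C x in Cx | X x in Xx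
  ... | true  | true  = true≢false (trans (sym Xx) (C-avoids-X Cx))
  ... | true  | false = Bool.∧-zeroʳ (V G x)
  ... | false | true  = cong (_∧ true) (X⊆V x Xx)
  ... | false | false = refl

  Z∩Y≗X : Z ∩ Y ≗ X
  Z∩Y≗X x = trans (Bool.∧-comm (Z x) (Y x)) (Y∩Z≗X x)

  Y∖Z-in-C : ∀ {x} → Y x ≡ true → Z x ≡ false → C x ≡ true
  Y∖Z-in-C {x} Yx Z∌x = decide (C x) refl
    where
    decide : ∀ c → C x ≡ c → C x ≡ true
    decide true  Cx = Cx
    decide false Cx = true≢false (trans (sym (cong (_∧ true) (Y⊆V x Yx)))
                                        (trans (cong (λ c → V G x ∧ not c) (sym Cx)) Z∌x))

  Z-avoids-C : ∀ {x} → Z x ≡ true → C x ≡ false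
  Z-avoids-C Zx = not-true (proj₂ (∧-true Zx))

  Y-Z-apart : NoEdgeBetween G Y Z
  Y-Z-apart x y e Yx Z∌x Zy Y∌y = true≢false (trans (sym (C-closed (Y∖Z-in-C Yx Z∌x) e X∌y)) (Z-avoids-C Zy))
    where
    X∌y : X y ≡ false
    X∌y = proj₂ (∨-false {C y} Y∌y)

  -- All loops of a set between X and Y sit on X, since C carries none.
  loops-on-X : ∀ W → X ⊆ W → W ⊆ Y → iL G W ≡ iL G X
  loops-on-X W X⊆W W⊆Y = trans (iL≡weight G W) (trans (weight-agree (L G) agree) (sym (iL≡weight G X)))
    where
    agree : ∀ x → W x ≡ X x ⊎ L G x ≡ 0
    agree x with X x in Xx | W x in Wx
    ... | true  | true  = inj₁ refl
    ... | true  | false = ⊥-elim (true≢false (trans (sym (X⊆W x Xx)) Wx))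
    ... | false | false = inj₁ refl
    ... | false | true  = inj₂ (C-loopless (trans (sym (Bool.∨-identityʳ (C x)))
                                             (trans (cong (C x ∨_) (sym Xx)) (W⊆Y x Wx))))

  Z∌w : Z w ≡ false
  Z∌w = trans (cong (λ c → V G w ∧ not c) Cw) (Bool.∧-zeroʳ (V G w))

  Z≉V : ¬ (Z ≗ V G)
  Z≉V Z≗V = true≢false (trans (sym Vw) (trans (sym (Z≗V w)) Z∌w))

  tight-sides : iE G X ≡ 0 × iE G Y + 3 ≡ 2 * card Y × iE G Z + iL G Z ≡ 2 * card Z
  tight-sides = tight-split (iE G (V G) + iL G (V G)) (iE G X) (iE G Y) (iE G Z + iL G Z)
                            (card (V G)) (card Y) (card Z)
    (merge-loops (iE G (V G)) (iE G X) (iE G Y) (iE G Z) (iL G (V G)) (iL G X) (iL G Z) edges loops)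
    vertices count
    (sparse Y Y⊆V (card-two {W = Y} a≢b (X⊆Y a (pairSet-fst a b)) (X⊆Y b (pairSet-snd a b))))
    (proper Z (Z⊆V , Z≉V))
    where
    edges : iE G (V G) + iE G X ≡ iE G Y + iE G Z
    edges = trans (cong₂ _+_ (sym (iE-cong G Y∪Z≗V)) (sym (iE-cong G Y∩Z≗X))) (iE-mod G Y Z Y-Z-apart)
    loops : iL G (V G) + iL G X ≡ iL G X + iL G Z
    loops = trans (cong₂ _+_ (sym (iL-cong G Y∪Z≗V)) (sym (iL-cong G Y∩Z≗X)))
                  (trans (iL-mod G Y Z) (cong (_+ iL G Z) (loops-on-X Y X⊆Y (λ _ Yx → Yx))))
    vertices : card (V G) + 2 ≡ card Y + card Z
    vertices = trans (cong₂ _+_ (sym (card-cong Y∪Z≗V)) (sym (trans (card-cong Y∩Z≗X) (card-pairSet a≢b))))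
                     (card-mod Y Z)

  ab∉E : E G a b ≡ false
  ab∉E = no-edge-inside G {X} (proj₁ tight-sides) (pairSet-fst a b) (pairSet-snd a b)

  Y-tight : iE G Y + 3 ≡ 2 * card Y
  Y-tight = proj₁ (proj₂ tight-sides)

  Z-tight : iE G Z + iL G Z ≡ 2 * card Z
  Z-tight = proj₂ (proj₂ tight-sides)

  module Glue (W S T : VSet n) (X⊆W : X ⊆ W) (W⊆S : W ⊆ S) (S∩T≗X : S ∩ T ≗ X)
              (apart : NoEdgeBetween G S T) where

    W∩T≗X : W ∩ T ≗ X
    W∩T≗X = squeeze X⊆W W⊆S S∩T≗X

    glue-edges : iE G (W ∪ T) ≡ iE G W + iE G T
    glue-edges = trans (sym (+-identityʳ _))
      (trans (cong (iE G (W ∪ T) +_) (sym (trans (iE-cong G W∩T≗X) (proj₁ tight-sides))))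
             (iE-mod G W T (NoEdgeBetween-shrink G apart W⊆S S∩T⊆W)))
      where
      S∩T⊆W : (S ∩ T) ⊆ W
      S∩T⊆W x S∩Tx = X⊆W x (trans (sym (S∩T≗X x)) S∩Tx)

    glue-cards : card (W ∪ T) + 2 ≡ card W + card T
    glue-cards = trans (cong (card (W ∪ T) +_) (sym (trans (card-cong W∩T≗X) (card-pairSet a≢b))))
                       (card-mod W T)

    glue-loops : iL G (W ∪ T) + iL G X ≡ iL G W + iL G T
    glue-loops = trans (cong (iL G (W ∪ T) +_) (sym (iL-cong G W∩T≗X))) (iL-mod G W T)

  Za : Z a ≡ true
  Za = X⊆Z a (pairSet-fst a b)
  Zb : Z b ≡ true
  Zb = X⊆Z b (pairSet-snd a b)
  Ya : Y a ≡ true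
  Ya = X⊆Y a (pairSet-fst a b)
  Yb : Y b ≡ true
  Yb = X⊆Y b (pairSet-snd a b)

  Z-loops : ∀ x → Z x ≡ false → L G x ≡ 0
  Z-loops x Z∌x with V G x in Vx | C x in Cx
  ... | false | _     = L-V G x Vx
  ... | true  | true  = C-loopless Cx
  ... | true  | false = true≢false Z∌x

  G₁ G₂ : LGraph n
  G₁ = withEdge G Z a≢b Za Zb (L G) Z-loops
  G₂ = withEdge G Y a≢b Ya Yb (λ _ → 0) (λ _ _ → refl)

  G₁-edges : ∀ W → W ⊆ Z → iE G₁ W ≡ iE G W + b2n (W a ∧ W b)
  G₁-edges = withEdge-iE G Z a≢b Za Zb (L G) Z-loops ab∉E

  G₁-loops : ∀ W → iL G₁ W ≡ iL G W
  G₁-loops W = trans (iL≡weight G₁ W) (sym (iL≡weight G W))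

  G₂-edges : ∀ W → W ⊆ Y → iE G₂ W ≡ iE G W + b2n (W a ∧ W b)
  G₂-edges = withEdge-iE G Y a≢b Ya Yb (λ _ → 0) (λ _ _ → refl) ab∉E

  plus-one : ∀ {W : VSet n} {e} → W a ≡ true → W b ≡ true → e + b2n (W a ∧ W b) ≡ e + 1
  plus-one {e = e} Wa Wb = cong (λ c → e + b2n c) (cong₂ _∧_ Wa Wb)

  plus-zero : ∀ {W : VSet n} {e} → (W a ∧ W b) ≡ false → e + b2n (W a ∧ W b) ≡ e
  plus-zero {e = e} ¬ab = trans (cong (λ c → e + b2n c) ¬ab) (+-identityʳ e)

  edge-cover : ∀ x y → E G x y ≡ true → ((Z x ∧ Z y) ∨ (Y x ∧ Y y)) ≡ true
  edge-cover x y e = by (C x) refl (C y) refl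
    where
    reaches : ∀ {p q} → C p ≡ true → E G p q ≡ true → Y q ≡ true
    reaches {p} {q} Cp epq = through (X q) refl
      where
      through : ∀ t → X q ≡ t → Y q ≡ true
      through true  Xq = ∨-introʳ (C q) Xq
      through false Xq = cong (_∨ X q) (C-closed Cp epq Xq)
    in-Z : ∀ {p} → V G p ≡ true → C p ≡ false → Z p ≡ true
    in-Z Vp Cp = cong₂ (λ v c → v ∧ not c) Vp Cp
    by : ∀ c → C x ≡ c → ∀ c′ → C y ≡ c′ → ((Z x ∧ Z y) ∨ (Y x ∧ Y y)) ≡ true
    by true  Cx _     _  = ∨-introʳ (Z x ∧ Z y) (cong₂ _∧_ (cong (_∨ X x) Cx) (reaches Cx e))
    by false Cx true  Cy =
      ∨-introʳ (Z x ∧ Z y) (cong₂ _∧_ (reaches Cy (trans (E-sym G y x) e)) (cong (_∨ X y) Cy))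
    by false Cx false Cy = cong (_∨ (Y x ∧ Y y))
      (cong₂ _∧_ (in-Z (E-V G x y e) Cx) (in-Z (E-V G y x (trans (E-sym G y x) e)) Cy))

  -- Boolean shape of the two edge conditions of a 2-sum, with p, q: "xy lies in Z", "xy lies in Y".
  shared-edges : ∀ e p q j → (e ≡ true → p ≡ true → q ≡ true → j ≡ true) →
    (((e ∧ p) ∨ j) ∧ ((e ∧ q) ∨ j)) ≡ j
  shared-edges true  true  true  j     both = sym (both refl refl refl)
  shared-edges true  true  false true  _    = refl
  shared-edges true  true  false false _    = refl
  shared-edges true  false q     true  _    = Bool.∨-zeroʳ q
  shared-edges true  false q     false _    = refl
  shared-edges false p     q     true  _    = refl
  shared-edges false p     q     false _    = refl

  all-edges : ∀ e p q j → (e ≡ true → (p ∨ q) ≡ true) → (e ∧ j) ≡ false →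
    e ≡ (((e ∧ p) ∨ j) ∨ ((e ∧ q) ∨ j)) ∧ not j
  all-edges true  true  q     false _ _ = refl
  all-edges true  false true  false _ _ = refl
  all-edges true  false false false cover _ = true≢false (sym (cover refl))
  all-edges false p     q     true  _ _ = refl
  all-edges false p     q     false _ _ = refl

  two-sum : IsTwoSum G G₁ G₂
  two-sum = a , b , V-∪ , Z∩Y≗X , E-∩ , E-∪ , λ x → sym (+-identityʳ (L G x))
    where
    V-∪ : ∀ x → V G x ≡ (Z x ∨ Y x)
    V-∪ x = trans (sym (Y∪Z≗V x)) (Bool.∨-comm (Y x) (Z x))
    E-∩ : ∀ x y → (plusEdge G Z a b x y ∧ plusEdge G Y a b x y) ≡ joins a b x y
    E-∩ x y = shared-edges (E G x y) (Z x ∧ Z y) (Y x ∧ Y y) (joins a b x y) on-X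
      where
      on-X : E G x y ≡ true → (Z x ∧ Z y) ≡ true → (Y x ∧ Y y) ≡ true → joins a b x y ≡ true
      on-X e Zxy Yxy = joins-ends {x = x} {y} a≢b
        (trans (sym (Z∩Y≗X x)) (cong₂ _∧_ (proj₁ (∧-true {Z x} Zxy)) (proj₁ (∧-true {Y x} Yxy))))
        (trans (sym (Z∩Y≗X y)) (cong₂ _∧_ (proj₂ (∧-true {Z x} Zxy)) (proj₂ (∧-true {Y x} Yxy))))
        (λ { refl → true≢false (trans (sym e) (E-irr G x)) })
    E-∪ : ∀ x y → E G x y ≡ ((plusEdge G Z a b x y ∨ plusEdge G Y a b x y) ∧ not (joins a b x y))
    E-∪ x y = all-edges (E G x y) (Z x ∧ Z y) (Y x ∧ Y y) (joins a b x y) (edge-cover x y)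
                        (non-edge-joins G ab∉E x y)

  rigid₁ : RigidCircuit G₁
  rigid₁ = count₁ , sparse₁ , proper₁
    where
    W⊆V : ∀ {W} → W ⊆ Z → W ⊆ V G
    W⊆V W⊆Z x Wx = Z⊆V x (W⊆Z x Wx)

    count₁ : iE G₁ Z + iL G₁ Z ≡ 2 * card Z + 1
    count₁ = begin
      iE G₁ Z + iL G₁ Z
        ≡⟨ cong₂ _+_ (trans (G₁-edges Z (λ _ Zx → Zx)) (plus-one {Z} Za Zb)) (G₁-loops Z) ⟩
      iE G Z + 1 + iL G Z       ≡⟨ one-more (iE G Z) (iL G Z) ⟩
      iE G Z + iL G Z + 1       ≡⟨ cong (_+ 1) Z-tight ⟩
      2 * card Z + 1            ∎
      where open ≡-Reasoning

    sparse₁ : ∀ W → W ⊆ V G₁ → 2 ≤ card W → iE G₁ W + 3 ≤ 2 * card W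
    sparse₁ W W⊆Z 2≤W with W a ∧ W b in ab∈W
    ... | false = subst (λ e → e + 3 ≤ 2 * card W) (sym (trans (G₁-edges W W⊆Z) (plus-zero {W} ab∈W)))
                        (sparse W (W⊆V W⊆Z) 2≤W)
    ... | true  = subst (λ e → e + 3 ≤ 2 * card W) (sym (trans (G₁-edges W W⊆Z) (plus-one {W} Wa Wb)))
                        (subst (_≤ 2 * card W) (sym (+-assoc (iE G W) 1 3)) bound)
      where
      Wa : W a ≡ true
      Wa = proj₁ (∧-true ab∈W)
      Wb : W b ≡ true
      Wb = proj₂ (∧-true ab∈W)
      U : VSet n
      U = W ∪ Y
      open Glue W Z Y (pairSet-⊆ Wa Wb) W⊆Z Z∩Y≗X (NoEdgeBetween-sym G Y-Z-apart)
      bound : iE G W + 4 ≤ 2 * card W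
      bound = cut-tight (iE G U) (iE G W) (iE G Y) (card U) (card W) (card Y) 4
        glue-edges glue-cards
        (sparse U (∪-⊆ (W⊆V W⊆Z) Y⊆V) (card-two {W = U} a≢b (cong (_∨ Y a) Wa) (cong (_∨ Y b) Wb)))
        Y-tight (≤ᵇ⇒≤ _ _ _)

    proper₁ : ∀ W → W ⊊ V G₁ → iEL G₁ W ≤ 2 * card W
    proper₁ W (W⊆Z , W≉Z) with W a ∧ W b in ab∈W
    ... | false = subst (_≤ 2 * card W)
                        (sym (cong₂ _+_ (trans (G₁-edges W W⊆Z) (plus-zero {W} ab∈W)) (G₁-loops W)))
                        (proper W (W⊆V W⊆Z , W≉V))
      where
      W≉V : ¬ (W ≗ V G)
      W≉V W≗V = true≢false (trans (sym (W⊆Z w (trans (W≗V w) Vw))) Z∌w)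
    ... | true  = subst (_≤ 2 * card W)
                        (sym (trans (cong₂ _+_ (trans (G₁-edges W W⊆Z) (plus-one {W} Wa Wb)) (G₁-loops W))
                                    (one-more (iE G W) (iL G W))))
                        bound
      where
      Wa : W a ≡ true
      Wa = proj₁ (∧-true ab∈W)
      Wb : W b ≡ true
      Wb = proj₂ (∧-true ab∈W)
      U : VSet n
      U = W ∪ Y
      X⊆W : X ⊆ W
      X⊆W = pairSet-⊆ Wa Wb
      open Glue W Z Y X⊆W W⊆Z Z∩Y≗X (NoEdgeBetween-sym G Y-Z-apart)
      missing : ∃[ z ] (W z ≡ false × Z z ≡ true)
      missing = ⊊-witness W⊆Z W≉Z
      z : Fin n
      z = proj₁ missing
      U≉V : ¬ (U ≗ V G)
      U≉V U≗V = true≢false (trans (sym (trans (U≗V z) (Z⊆V z (proj₂ (proj₂ missing))))) U∌z)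
        where
        W∌z : W z ≡ false
        W∌z = proj₁ (proj₂ missing)
        X∌z : X z ≡ false
        X∌z = false-if-not-true λ Xz → true≢false (trans (sym (X⊆W z Xz)) W∌z)
        U∌z : U z ≡ false
        U∌z = cong₂ _∨_ W∌z (cong₂ _∨_ (Z-avoids-C (proj₂ (proj₂ missing))) X∌z)
      loops-U : iL G U ≡ iL G W
      loops-U = +-cancelʳ-≡ (iL G X) (iL G U) (iL G W)
        (trans glue-loops (cong (iL G W +_) (loops-on-X Y X⊆Y (λ _ Yx → Yx))))
      bound : iE G W + iL G W + 1 ≤ 2 * card W
      bound = cut-tight (iE G U + iL G U) (iE G W + iL G W) (iE G Y) (card U) (card W) (card Y) 1
        (loops-left (iE G U) (iE G W) (iE G Y) (iL G U) (iL G W) glue-edges loops-U) glue-cards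
        (+0-intro (proper U (∪-⊆ (W⊆V W⊆Z) Y⊆V , U≉V))) Y-tight (≤ᵇ⇒≤ _ _ _)

  flexible₂ : FlexibleCircuit G₂
  flexible₂ = (λ _ → refl) , count₂ , proper₂
    where
    count₂ : iE G₂ Y + 2 ≡ 2 * card Y
    count₂ = trans (cong (_+ 2) (trans (G₂-edges Y (λ _ Yx → Yx)) (plus-one {Y} Ya Yb)))
                   (trans (+-assoc (iE G Y) 1 2) Y-tight)

    proper₂ : ∀ W → W ⊊ V G₂ → 2 ≤ card W → iE G₂ W + 3 ≤ 2 * card W
    proper₂ W (W⊆Y , W≉Y) 2≤W with W a ∧ W b in ab∈W
    ... | false = subst (λ e → e + 3 ≤ 2 * card W) (sym (trans (G₂-edges W W⊆Y) (plus-zero {W} ab∈W)))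
                        (sparse W (λ x Wx → Y⊆V x (W⊆Y x Wx)) 2≤W)
    ... | true  = subst (λ e → e + 3 ≤ 2 * card W) (sym (trans (G₂-edges W W⊆Y) (plus-one {W} Wa Wb)))
                        (subst (_≤ 2 * card W) (sym (+-assoc (iE G W) 1 3)) bound)
      where
      Wa : W a ≡ true
      Wa = proj₁ (∧-true ab∈W)
      Wb : W b ≡ true
      Wb = proj₂ (∧-true ab∈W)
      U : VSet n
      U = W ∪ Z
      X⊆W : X ⊆ W
      X⊆W = pairSet-⊆ Wa Wb
      open Glue W Y Z X⊆W W⊆Y Y∩Z≗X Y-Z-apart
      missing : ∃[ z ] (W z ≡ false × Y z ≡ true)
      missing = ⊊-witness W⊆Y W≉Y
      z : Fin n
      z = proj₁ missing
      U≉V : ¬ (U ≗ V G)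
      U≉V U≗V = true≢false (trans (sym (trans (U≗V z) (Y⊆V z (proj₂ (proj₂ missing))))) U∌z)
        where
        W∌z : W z ≡ false
        W∌z = proj₁ (proj₂ missing)
        X∌z : X z ≡ false
        X∌z = false-if-not-true λ Xz → true≢false (trans (sym (X⊆W z Xz)) W∌z)
        Cz : C z ≡ true
        Cz = trans (sym (Bool.∨-identityʳ (C z))) (trans (cong (C z ∨_) (sym X∌z)) (proj₂ (proj₂ missing)))
        U∌z : U z ≡ false
        U∌z = cong₂ _∨_ W∌z (trans (cong (λ c → V G z ∧ not c) Cz) (Bool.∧-zeroʳ (V G z)))
      loops-U : iL G U ≡ iL G Z
      loops-U = +-cancelʳ-≡ (iL G X) (iL G U) (iL G Z)
        (trans glue-loops (trans (cong (_+ iL G Z) (loops-on-X W X⊆W W⊆Y)) (+-comm (iL G X) (iL G Z))))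
      bound : iE G W + 4 ≤ 2 * card W
      bound = cut-tight (iE G U + iL G U) (iE G W) (iE G Z + iL G Z) (card U) (card W) (card Z) 4
        (loops-right (iE G U) (iE G W) (iE G Z) (iL G U) (iL G Z) glue-edges loops-U) glue-cards
        (+0-intro (proper U (∪-⊆ (λ x Wx → Y⊆V x (W⊆Y x Wx)) Z⊆V , U≉V)))
        (trans (+-identityʳ _) Z-tight) (≤ᵇ⇒≤ _ _ _)

  decomposition : TwoSumOfCircuits G
  decomposition = G₁ , G₂ , two-sum , rigid₁ , flexible₂

lemma5p9 : ∀ {n} (G : LGraph n) →
    (RigidCircuit G × ¬ Balanced G) ⇔
    (∃[ G₁ ] ∃[ G₂ ] (IsTwoSum G G₁ G₂ × RigidCircuit G₁ × FlexibleCircuit G₂))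
lemma5p9 G = mk⇔ split glue
  where
  split : RigidCircuit G × ¬ Balanced G → TwoSumOfCircuits G
  split (rigid , unbalanced) =
    let (_ , _ , _ , piece) = unbalanced-witness G unbalanced
    in Separation.decomposition G rigid piece
  glue : TwoSumOfCircuits G → RigidCircuit G × ¬ Balanced G
  glue (G₁ , G₂ , (u , v , V-∪ , V-∩ , E-∩ , E-∪ , L-+) , rigid₁ , flexible₂) =
    TwoSum.rigid-not-balanced {G = G} {G₁} {G₂} {u} {v} V-∪ V-∩ E-∩ E-∪ L-+ rigid₁ flexible₂
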